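{- Let $M$ be a term of the $\partial_0\lambda$-calculus with tests, $\vec x=x_1,\dots,x_n$ a repetition-free list of variables containing the free variables of $M$, $\alpha\in\mathcal D$ and $\vec a=(a_1,\dots,a_n)\in\mathcal M_f(\mathcal D)^n$. Then $(\vec a,\alpha)\in\llbracket M\rrbracket_{\vec x}$ if and only if $\alpha^-[M\langle\vec a^+/\vec x\rangle]\twoheadrightarrow\varepsilon$.
   Context: Syntax of the $\partial_0\lambda$-calculus with tests. Terms $M ::= x \mid \lambda x.M \mid MP \mid \bar\tau(V)$, bags $P ::= [L_1,\dots,L_k]$, tests $V ::= \tau[L_1,\dots,L_k]$ ($k\ge 0$; finite multisets of terms, the tag $\tau$ distinguishes tests from bags), up to $\alpha$-equivalence. $\varepsilon:=\tau[\,]$; $V\mid W$ is multiset union of tests. Sums are finite formal sums with idempotent addition, $0$ the empty sum; constructors extend multilinearly to sums (e.g. $(\sum_iM_i)(\sum_jP_j)=\sum_{i,j}M_iP_j$, $\tau[\sum_iM_i]\mid V=\sum_i\tau[M_i]\mid V$) and give $0$ on $0$. $A\{0/x\}=0$ if $x$ is free in $A$, else $A$. Linear substitution: $x\langle N/x\rangle=N$; $y\langle N/x\rangle=0$ ($y\ne x$); $(\lambda y.M)\langle N/x\rangle=\lambda y.M\langle N/x\rangle$; $(MP)\langle N/x\rangle=M\langle N/x\rangle P+M(P\langle N/x\rangle)$; $\bar\tau(V)\langle N/x\rangle=\bar\tau(V\langle N/x\rangle)$; $[L_1,\dots,L_k]\langle N/x\rangle=\sum_i[L_1,\dots,L_i\langle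 N/x\rangle,\dots,L_k]$, likewise for tests; for a bag $P=[L_1,\dots,L_k]$ with $x$ not free in $P$, $A\langle P/x\rangle:=A\langle L_1/x\rangle\cdots\langle L_k/x\rangle$, and $A\langle\vec P/\vec x\rangle:=A\langle P_1/x_1\rangle\cdots\langle P_n/x_n\rangle$. Reduction: $(\lambda x.M)P\to M\langle P/x\rangle\{0/x\}$; $\bar\tau(V)P\to\bar\tau(V)$ if $P=[\,]$, else $\to0$; $\tau[\lambda x.M]\mid V\to\tau[M\{0/x\}]\mid V$; $\tau[\bar\tau(V)]\mid W\to V\mid W$; $\to$ is the closure under all syntactic positions and under sums, $\twoheadrightarrow$ its reflexive-transitive closure. A test-context is a test with one hole in term position; $C[M]$ replaces the hole by $M$ (allowing capture). The model $\mathcal D$. $\mathcal M_f(S)$ = finite multisets over $S$; $D_0=\emptyset$, $D_{n+1}$ = $\mathbb N$-indexed sequences $(a_1,a_2,\dots)$ of elements of $\mathcal M_f(D_n)$ with all but finitely many empty; $\mathcal D=\bigcup_nD_n$; $a::(a_1,a_2,\dots):=(a,a_1,a_2,\dots)$; $*:=([\,],[\,],\dots)$; $\uplus$ on tuples is componentwise. For a repetition-free list $\vec x$ containing the free variables: $\llbracket x_i\rrbracket_{\vec x}=\{(([\,],\dots,[\alpha],\dots,[\,]),\alpha):\alpha\in\mathcal D\}$ ($[\alpha]$ in position $i$); $\llbracket\lambda y.M\rrbracket_{\vec x}=\{(\vec a,b::\alpha):((\vec a,b),\alpha)\in\llbracket M\rrbracket_{\vec x,y}\}$; $\llbracket MP\rrbracket_{\vec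 x}=\{(\vec a_1\uplus\vec a_2,\alpha):\exists b\,(\vec a_1,b::\alpha)\in\llbracket M\rrbracket_{\vec x},(\vec a_2,b)\in\llbracket P\rrbracket_{\vec x}\}$; $\llbracket\bar\tau(V)\rrbracket_{\vec x}=\{(\vec a,*):\vec a\in\llbracket V\rrbracket_{\vec x}\}$; $\llbracket[L_1,\dots,L_k]\rrbracket_{\vec x}=\{(\biguplus_i\vec a_i,[\beta_1,\dots,\beta_k]):(\vec a_i,\beta_i)\in\llbracket L_i\rrbracket_{\vec x}\}$; $\llbracket\tau[L_1,\dots,L_k]\rrbracket_{\vec x}=\{\biguplus_i\vec a_i:(\vec a_i,*)\in\llbracket L_i\rrbracket_{\vec x}\}$; sums as unions. Terms $\alpha^+$ and test-contexts $\alpha^-$. The length $\ell(\alpha)$ is $0$ if $\alpha=*$, otherwise the unique $r$ with $\alpha=a_1::\cdots::a_r::*$, $a_r\ne[\,]$. For $\alpha=[\alpha_{1,1},\dots,\alpha_{1,k_1}]::\cdots::[\alpha_{r,1},\dots,\alpha_{r,k_r}]::*$ with $r=\ell(\alpha)$, define by mutual (well-founded) induction the closed term $\alpha^+=\lambda x_1\dots x_r.\bar\tau\big(\|_{i=1}^r(\alpha_{i,1}^-[x_i]\mid\cdots\mid\alpha_{i,k_i}^-[x_i])\big)$ (empty parallel composition being $\varepsilon$) and the test-context $\alpha^-[\cdot]=\tau\big[[\cdot][\alpha_{1,1}^+,\dots,\alpha_{1,k_1}^+]\cdots[\alpha_{r,1}^+,\dots,\alpha_{r,k_r}^+]\big]$.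 For $a=[\alpha_1,\dots,\alpha_k]$, $a^+:=[\alpha_1^+,\dots,\alpha_k^+]$, and $\vec a^+:=(a_1^+,\dots,a_n^+)$. -}

module Defs where

open import Data.Nat using (ℕ; zero; suc)
open import Data.Fin using (Fin; zero; suc; opposite; punchOut; _≟_)
open import Data.List using (List; []; _∷_; _++_; map; concatMap; foldl; length)
open import Data.List.Relation.Unary.All using (All)
open import Data.List.Relation.Unary.Any using (Any)
open import Data.Vec using (Vec; replicate; zipWith; allFin; toList; zip; _[_]≔_)
open import Data.Vec.Relation.Binary.Pointwise.Inductive using (Pointwise)
open import Data.Maybe using (Maybe; just; nothing)
open import Data.Product using (_×_; _,_; Σ; ∃)
open import Relation.Nullary using (yes; no)
open import Relation.Binary.Construct.Closure.ReflexiveTransitive using (Star)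

-- Syntax (well-scoped de Bruijn; Term n = terms whose free variables
-- are among n variables x_0 … x_{n-1}, x_i = var i).
-- Bags and tests are both represented by lists of terms (finite
-- multisets; the order is quotiented by _≃L_ below).  A test
-- τ[L₁,…,L_k] is the list L₁ ∷ … ∷ L_k ∷ [] of type Test n.

data Term (n : ℕ) : Set where
  var  : Fin n → Term n
  lam  : Term (suc n) → Term n
  app  : Term n → List (Term n) → Term n
  tbar : List (Term n) → Term n

Bag : ℕ → Set
Bag n = List (Term n)

Test : ℕ → Set
Test n = List (Term n)

-- finite formal sums (idempotent addition: quotiented by _≈Σ_ below);
-- 0 is the empty sum
Sum : Set → Set
Sum A = List A

ε : ∀ {n} → Test n
ε = []

-- Structural equivalence: bags/tests are multisets (permutation
-- congruence).  α-equivalence is built in (de Bruijn).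

mutual
  data _≃_ {n : ℕ} : Term n → Term n → Set where
    var  : ∀ {i} → var i ≃ var i
    lam  : ∀ {M M'} → M ≃ M' → lam M ≃ lam M'
    app  : ∀ {M M' P P'} → M ≃ M' → P ≃L P' → app M P ≃ app M' P'
    tbar : ∀ {V V'} → V ≃L V' → tbar V ≃ tbar V'

  data _≃L_ {n : ℕ} : List (Term n) → List (Term n) → Set where
    []    : [] ≃L []
    _∷_   : ∀ {L L' P P'} → L ≃ L' → P ≃L P' → (L ∷ P) ≃L (L' ∷ P')
    swap  : ∀ {L L' P} → (L ∷ L' ∷ P) ≃L (L' ∷ L ∷ P)
    trans : ∀ {P Q R} → P ≃L Q → Q ≃L R → P ≃L R

_≈Σ[_]_ : ∀ {A : Set} → Sum A → (A → A → Set) → Sum A → Set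
S ≈Σ[ R ] S' = All (λ A → Any (λ B → R A B) S') S × All (λ B → Any (λ A → R A B) S) S'

mutual
  ren : ∀ {m k} → (Fin m → Fin k) → Term m → Term k
  ren ρ (var i)  = var (ρ i)
  ren ρ (lam M)  = lam (ren (ext ρ) M)
  ren ρ (app M P) = app (ren ρ M) (renL ρ P)
  ren ρ (tbar V) = tbar (renL ρ V)

  renL : ∀ {m k} → (Fin m → Fin k) → List (Term m) → List (Term k)
  renL ρ [] = []
  renL ρ (L ∷ P) = ren ρ L ∷ renL ρ P

  ext : ∀ {m k} → (Fin m → Fin k) → Fin (suc m) → Fin (suc k)
  ext ρ zero = zero
  ext ρ (suc i) = suc (ρ i)

closed : ∀ {m} → Term 0 → Term m
closed = ren (λ ())

mutual
  str : ∀ {m} → Fin (suc m) → Term (suc m) → Maybe (Term m)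
  str i (var j) with i ≟ j
  ... | yes _ = nothing
  ... | no ne = just (var (punchOut ne))
  str i (lam M) with str (suc i) M
  ... | just M' = just (lam M')
  ... | nothing = nothing
  str i (app M P) with str i M | strL i P
  ... | just M' | just P' = just (app M' P')
  ... | _ | _ = nothing
  str i (tbar V) with strL i V
  ... | just V' = just (tbar V')
  ... | nothing = nothing

  strL : ∀ {m} → Fin (suc m) → List (Term (suc m)) → Maybe (List (Term m))
  strL i [] = just []
  strL i (L ∷ P) with str i L | strL i P
  ... | just L' | just P' = just (L' ∷ P')
  ... | _ | _ = nothing

-- A{0/x} for x the variable bound last (de Bruijn 0)
zeroSub : ∀ {m} → Term (suc m) → Sum (Term m)
zeroSub M with str zero M
... | just M' = M' ∷ []
... | nothing = []

-- Linear substitution A⟨N/x⟩ (x not free in N)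

mutual
  lsub : ∀ {m} → Term m → Fin m → Term m → Sum (Term m)
  lsub (var y) x N with x ≟ y
  ... | yes _ = N ∷ []
  ... | no _  = []
  lsub (lam M) x N = map lam (lsub M (suc x) (ren suc N))
  lsub (app M P) x N = map (λ M' → app M' P) (lsub M x N) ++ map (app M) (lsubL P x N)
  lsub (tbar V) x N = map tbar (lsubL V x N)

  lsubL : ∀ {m} → List (Term m) → Fin m → Term m → Sum (List (Term m))
  lsubL [] x N = []
  lsubL (L ∷ P) x N = map (_∷ P) (lsub L x N) ++ map (L ∷_) (lsubL P x N)

lsubΣ : ∀ {m} → Sum (Term m) → Fin m → Term m → Sum (Term m)
lsubΣ S x N = concatMap (λ A → lsub A x N) S

lsubBag : ∀ {m} → Sum (Term m) → Fin m → Bag m → Sum (Term m)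
lsubBag S x P = foldl (λ S' L → lsubΣ S' x L) S P

mutual
  data _⟶_ {n : ℕ} : Term n → Sum (Term n) → Set where
    β      : ∀ {M P} → app (lam M) P ⟶ concatMap zeroSub (lsubBag (M ∷ []) zero (renL suc P))
    βτ-nil : ∀ {V} → app (tbar V) [] ⟶ (tbar V ∷ [])
    βτ-cons : ∀ {V L P} → app (tbar V) (L ∷ P) ⟶ []
    lamC   : ∀ {M S} → M ⟶ S → lam M ⟶ map lam S
    appL   : ∀ {M P S} → M ⟶ S → app M P ⟶ map (λ M' → app M' P) S
    appR   : ∀ {M P S} → P ⟶L S → app M P ⟶ map (app M) S
    tbarC  : ∀ {V S} → V ⟶T S → tbar V ⟶ map tbar S

  data _⟶L_ {n : ℕ} : List (Term n) → Sum (List (Term n)) → Set where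
    here  : ∀ {L P S} → L ⟶ S → (L ∷ P) ⟶L map (_∷ P) S
    there : ∀ {L P S} → P ⟶L S → (L ∷ P) ⟶L map (L ∷_) S

  data _⟶T_ {n : ℕ} : Test n → Sum (Test n) → Set where
    τλ    : ∀ {M V} → (lam M ∷ V) ⟶T map (_∷ V) (zeroSub M)
    ττ    : ∀ {V W} → (tbar V ∷ W) ⟶T ((V ++ W) ∷ [])
    here  : ∀ {L V S} → L ⟶ S → (L ∷ V) ⟶T map (_∷ V) S
    there : ∀ {L V S} → V ⟶T S → (L ∷ V) ⟶T map (L ∷_) S

data SumStep {A : Set} (R : A → A → Set) (_⇒_ : A → Sum A → Set) (S S' : Sum A) : Set where
  step : ∀ {a B T} → S ≈Σ[ R ] (a ∷ B) → a ⇒ T → S' ≈Σ[ R ] (T ++ B) → SumStep R _⇒_ S S'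

_↠T_ : ∀ {n} → Sum (Test n) → Sum (Test n) → Set
S ↠T S' = Σ _ λ S'' → Star (SumStep _≃L_ _⟶T_) S S'' × S'' ≈Σ[ _≃L_ ] S'

-- The model 𝒟.  mk (a₁ ∷ … ∷ a_k ∷ []) represents a₁::⋯::a_k::*;
-- multisets are lists; equality of 𝒟 is _≈D_ (multisets up to
-- permutation, trailing empty multisets irrelevant).

data D : Set where
  mk : List (List D) → D

MF : Set
MF = List D

_::_ : MF → D → D
a :: mk as = mk (a ∷ as)

* : D
* = mk []

mutual
  data _≈D_ : D → D → Set where
    mk : ∀ {as bs} → as ≈S bs → mk as ≈D mk bs

  data _≈S_ : List MF → List MF → Set where
    []    : [] ≈S []
    _∷_   : ∀ {a b as bs} → a ≈M b → as ≈S bs → (a ∷ as) ≈S (b ∷ bs)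
    nil-l : ∀ {as} → as ≈S [] → ([] ∷ as) ≈S []
    nil-r : ∀ {bs} → [] ≈S bs → [] ≈S ([] ∷ bs)

  data _≈M_ : MF → MF → Set where
    []    : [] ≈M []
    _∷_   : ∀ {α β a b} → α ≈D β → a ≈M b → (α ∷ a) ≈M (β ∷ b)
    swap  : ∀ {α β a} → (α ∷ β ∷ a) ≈M (β ∷ α ∷ a)
    trans : ∀ {a b c} → a ≈M b → b ≈M c → a ≈M c

Env : ℕ → Set
Env n = Vec MF n

_≈E_ : ∀ {n} → Env n → Env n → Set
_≈E_ = Pointwise _≈M_

_⊎E_ : ∀ {n} → Env n → Env n → Env n
_⊎E_ = zipWith _++_

emptyE : ∀ {n} → Env n
emptyE = replicate _ []

singleE : ∀ {n} → Fin n → D → Env n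
singleE i α = emptyE [ i ]≔ (α ∷ [])

-- Interpretation ⟦·⟧_x⃗ as membership predicates.  de Bruijn: the
-- variable bound by λ is position 0 of the environment.

mutual
  data Sem {n : ℕ} : Term n → Env n → D → Set where
    s-var  : ∀ {i a α} → a ≈E singleE i α → Sem (var i) a α
    s-lam  : ∀ {M a b α β} → Sem M (b Data.Vec.∷ a) α → β ≈D (b :: α) → Sem (lam M) a β
    s-app  : ∀ {M P a a₁ a₂ b α} → Sem M a₁ (b :: α) → SemBag P a₂ b →
             a ≈E (a₁ ⊎E a₂) → Sem (app M P) a α
    s-tbar : ∀ {V a β} → SemTest V a → β ≈D * → Sem (tbar V) a β

  data SemBag {n : ℕ} : Bag n → Env n → MF → Set where
    b-nil  : ∀ {a b} → a ≈E emptyE → b ≈M [] → SemBag [] a b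
    b-cons : ∀ {L P a a₁ a₂ β b b'} → Sem L a₁ β → SemBag P a₂ b →
             a ≈E (a₁ ⊎E a₂) → b' ≈M (β ∷ b) → SemBag (L ∷ P) a b'

  data SemTest {n : ℕ} : Test n → Env n → Set where
    t-nil  : ∀ {a} → a ≈E emptyE → SemTest [] a
    t-cons : ∀ {L V a a₁ a₂} → Sem L a₁ * → SemTest V a₂ →
             a ≈E (a₁ ⊎E a₂) → SemTest (L ∷ V) a

-- Normal form of representatives: trailing empty multisets removed
-- (recursively), so that for norm α = mk as, length as = ℓ(α).

consTrim : MF → List MF → List MF
consTrim [] [] = []
consTrim a as = a ∷ as

mutual
  norm : D → D
  norm (mk as) = mk (normS as)

  normS : List MF → List MF
  normS [] = []
  normS (a ∷ as) = consTrim (normM a) (normS as)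

  normM : MF → MF
  normM [] = []
  normM (α ∷ a) = norm α ∷ normM a

lams : (r : ℕ) → Term r → Term 0
lams zero t = t
lams (suc r) t = lams r (lam t)

mutual
  -- α⁺ = λx₁…x_r. τ̄(∥_i (α_{i,1}⁻[x_i] | ⋯ | α_{i,k_i}⁻[x_i]))
  plusN : D → Term 0
  plusN (mk as) = lams (length as) (tbar (body as opposite))

  -- x_{i+1} (bound by the (i+1)-th λ from the outside) is var (opposite i)
  body : ∀ {m} (as : List MF) → (Fin (length as) → Fin m) → Test m
  body [] f = []
  body (a ∷ as) f = bagTests a (var (f zero)) ++ body as (λ i → f (suc i))

  bagTests : ∀ {m} → MF → Term m → Test m
  bagTests [] t = []
  bagTests (α ∷ a) t = minusN α t ++ bagTests a t

  -- α⁻[t] = τ[ t [α_{1,·}⁺] ⋯ [α_{r,·}⁺] ]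
  minusN : ∀ {m} → D → Term m → Test m
  minusN (mk as) t = apps t as ∷ []

  apps : ∀ {m} → Term m → List MF → Term m
  apps t [] = t
  apps t (a ∷ as) = apps (app t (bagPlus a)) as

  bagPlus : ∀ {m} → MF → Bag m
  bagPlus [] = []
  bagPlus (α ∷ a) = closed (plusN α) ∷ bagPlus a

_⁺ : D → Term 0
α ⁺ = plusN (norm α)

_⁻[_] : ∀ {m} → D → Term m → Test m
α ⁻[ t ] = minusN (norm α) t

_⁺B : ∀ {m} → MF → Bag m
a ⁺B = bagPlus (normM a)

-- M⟨a⃗⁺/x⃗⟩ = M⟨a₁⁺/x₁⟩⋯⟨a_n⁺/x_n⟩
substAll : ∀ {n} → Term n → Env n → Sum (Term n)
substAll {n} M a = foldl (λ S p → lsubBag S (Data.Product.proj₁ p) (Data.Product.proj₂ p ⁺B))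
                         (M ∷ []) (toList (zip (allFin n) a))

_⁻[_]Σ : ∀ {m} → D → Sum (Term m) → Sum (Test m)
α ⁻[ S ]Σ = map (λ t → α ⁻[ t ]) S

module Submission where

-- The interpretation is invariant under reduction (subject reduction and expansion, whose key case
-- is the linear substitution lemma), α⁺ has α as its only point, and hence α⁻[t] succeeds in an
-- environment e exactly when (e , α) ∈ ⟦t⟧.  Substituting the closed bags a⁺ for x⃗ moves a⃗ from the
-- environment into the term, so (a⃗ , α) ∈ ⟦M⟧ iff some summand of α⁻[M⟨a⃗⁺/x⃗⟩] succeeds in the
-- empty environment.  If the sum reduces to ε this holds because ε does.  Conversely, by linearity
-- (|a_i| is the number of occurrences of x_i in M) every summand of M⟨a⃗⁺/x⃗⟩ is closed; closed tests
-- reduce, with decreasing size, to sums of copies of ε; and since the interpretation is preserved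
-- that sum is not empty, so it is ε.

open import Data.Empty using (⊥-elim)
open import Data.Fin using (Fin; zero; suc; punchIn; _≟_; opposite; fromℕ; inject₁)
open import Data.Fin.Properties using (punchIn-punchOut; suc-injective)
open import Data.List using (List; []; _∷_; _++_; length; [_]; map; concatMap; foldl)
open import Data.List.Membership.Propositional using (_∈_; find; lose)
open import Data.List.Membership.Propositional.Properties using (∈-map⁻; ∈-++⁻; ∈-concatMap⁻)
open import Data.List.Membership.Setoid.Properties using (∈-∃++)
open import Data.List.Properties using (++-assoc; ++-identityʳ; length-++)
open import Data.List.Relation.Binary.Permutation.Propositional using ()
  renaming (_↭_ to _↭ₚ_; ↭-sym to ↭ₚ-sym)
open import Data.List.Relation.Binary.Permutation.Propositional.Properties using ()
  renaming (∈-resp-↭ to ∈-resp-↭ₚ; shift to shiftₚ; shifts to shiftsₚ)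
import Data.List.Relation.Binary.Permutation.Setoid as Perm
import Data.List.Relation.Binary.Permutation.Setoid.Properties as PermProps
import Data.List.Relation.Binary.Pointwise as ListPW
open import Data.List.Relation.Unary.All as All using (All; []; _∷_)
import Data.List.Relation.Unary.All.Properties as AllProps
open import Data.List.Relation.Unary.Any as Any using (Any; here; there)
open import Data.List.Relation.Unary.Any.Properties
  using (map⁺; map⁻; ++⁺ˡ; ++⁺ʳ; ++⁻; concatMap⁺; concatMap⁻)
open import Data.Maybe using (just; nothing)
open import Data.Nat using (ℕ; zero; suc; _+_; _≤_; _<_; s≤s)
import Data.Nat as Nat
open import Data.Nat.Properties
  using ( +-assoc; +-comm; +-identityʳ; *-zeroʳ; *-identityʳ; +-cancelʳ-≡; m+n≡0⇒m≡0; m+n≡0⇒n≡0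
        ; ≤-refl; ≤-reflexive; ≤-trans; n≤0⇒n≡0; m≤m+n; n≤1+n; +-mono-≤; +-monoˡ-<; +-monoʳ-<
        ; +-commutativeSemigroup; module ≤-Reasoning )
open import Data.Product using (_×_; _,_; Σ; proj₁; proj₂)
open import Data.Sum using (_⊎_; inj₁; inj₂)
open import Data.Vec using (Vec; []; _∷_; lookup; _∷ʳ_; fromList; toList; zip; allFin; tabulate)
import Data.Vec.Relation.Binary.Pointwise.Inductive as VecPW
open VecPW using ([]; _∷_)
open import Function.Bundles using (_⇔_; mk⇔; Equivalence)
open import Function.Definitions using (Injective)
open import Function.Properties.Equivalence using () renaming (refl to ⇔-refl; trans to ⇔-trans)
open import Relation.Binary.Bundles using (Setoid)
open import Relation.Binary.Construct.Closure.ReflexiveTransitive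
  using (Star; _◅_; _◅◅_; gmap) renaming (ε to ε⋆; map to Star-map)
open import Relation.Binary.PropositionalEquality as ≡
  using (_≡_; _≢_; refl; cong; cong₂; subst; module ≡-Reasoning)
open import Relation.Nullary using (yes; no; ¬_)

open import Algebra.Properties.CommutativeSemigroup +-commutativeSemigroup using (xy∙z≈xz∙y; x∙yz≈xz∙y)

open import Defs

mutual
  ≈D-refl : ∀ {α} → α ≈D α
  ≈D-refl {mk as} = mk ≈S-refl

  ≈S-refl : ∀ {as} → as ≈S as
  ≈S-refl {[]} = []
  ≈S-refl {a ∷ as} = ≈M-refl ∷ ≈S-refl

  ≈M-refl : ∀ {a} → a ≈M a
  ≈M-refl {[]} = []
  ≈M-refl {α ∷ a} = ≈D-refl ∷ ≈M-refl

mutual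
  ≈D-sym : ∀ {α β} → α ≈D β → β ≈D α
  ≈D-sym (mk p) = mk (≈S-sym p)

  ≈S-sym : ∀ {as bs} → as ≈S bs → bs ≈S as
  ≈S-sym [] = []
  ≈S-sym (p ∷ ps) = ≈M-sym p ∷ ≈S-sym ps
  ≈S-sym (nil-l p) = nil-r (≈S-sym p)
  ≈S-sym (nil-r p) = nil-l (≈S-sym p)

  ≈M-sym : ∀ {a b} → a ≈M b → b ≈M a
  ≈M-sym [] = []
  ≈M-sym (p ∷ ps) = ≈D-sym p ∷ ≈M-sym ps
  ≈M-sym swap = swap
  ≈M-sym (trans p q) = trans (≈M-sym q) (≈M-sym p)

≈M-length : ∀ {a b} → a ≈M b → length a ≡ length b
≈M-length [] = refl
≈M-length (_ ∷ p) = cong suc (≈M-length p)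
≈M-length swap = refl
≈M-length (trans p q) = ≡.trans (≈M-length p) (≈M-length q)

≈M-[]⁻ : ∀ {a} → a ≈M [] → a ≡ []
≈M-[]⁻ {[]} _ = refl
≈M-[]⁻ {_ ∷ _} p with ≈M-length p
... | ()

mutual
  ≈D-trans : ∀ {α β γ} → α ≈D β → β ≈D γ → α ≈D γ
  ≈D-trans (mk p) (mk q) = mk (≈S-trans p q)

  ≈S-trans : ∀ {as bs cs} → as ≈S bs → bs ≈S cs → as ≈S cs
  ≈S-trans [] q = q
  ≈S-trans (p ∷ ps) (q ∷ qs) = trans p q ∷ ≈S-trans ps qs
  ≈S-trans (p ∷ ps) (nil-l qs) with ≈M-[]⁻ p
  ... | refl = nil-l (≈S-trans ps qs)
  ≈S-trans (nil-l ps) [] = nil-l ps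
  ≈S-trans (nil-l ps) (nil-r qs) = [] ∷ ≈S-trans ps qs
  ≈S-trans (nil-r ps) (q ∷ qs) with ≈M-[]⁻ (≈M-sym q)
  ... | refl = nil-r (≈S-trans ps qs)
  ≈S-trans (nil-r ps) (nil-l qs) = ≈S-trans ps qs

D-setoid : Setoid _ _
D-setoid = record
  { Carrier = D ; _≈_ = _≈D_
  ; isEquivalence = record { refl = ≈D-refl ; sym = ≈D-sym ; trans = ≈D-trans } }

open Perm D-setoid using (_↭_; ↭-refl; ↭-trans)
open PermProps D-setoid using (↭-shift; shifts; dropMiddleElement; ∈-resp-↭; ++-comm)
  renaming (++⁺ to ↭-++⁺)

-- _≈M_ is the permutation relation of D-setoid, so the library's permutation lemmas apply to it.
≈M⇒↭ : ∀ {a b} → a ≈M b → a ↭ b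
≈M⇒↭ [] = ↭-refl
≈M⇒↭ (p ∷ ps) = Perm.prep p (≈M⇒↭ ps)
≈M⇒↭ swap = Perm.↭-swap D-setoid _ _ ↭-refl
≈M⇒↭ (trans p q) = ↭-trans (≈M⇒↭ p) (≈M⇒↭ q)

↭⇒≈M : ∀ {a b} → a ↭ b → a ≈M b
↭⇒≈M (Perm.refl p) = pointwise p
  where
  pointwise : ∀ {a b} → ListPW.Pointwise _≈D_ a b → a ≈M b
  pointwise ListPW.[] = []
  pointwise (x ListPW.∷ xs) = x ∷ pointwise xs
↭⇒≈M (Perm.prep x p) = x ∷ ↭⇒≈M p
↭⇒≈M (Perm.swap x y p) = trans swap (y ∷ (x ∷ ↭⇒≈M p))
↭⇒≈M (Perm.trans p q) = trans (↭⇒≈M p) (↭⇒≈M q)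

≡⇒≈M : ∀ {a b} → a ≡ b → a ≈M b
≡⇒≈M refl = ≈M-refl

≈M-++⁺ : ∀ {a a' b b'} → a ≈M a' → b ≈M b' → (a ++ b) ≈M (a' ++ b')
≈M-++⁺ p q = ↭⇒≈M (↭-++⁺ (≈M⇒↭ p) (≈M⇒↭ q))

≈M-++-comm : ∀ a b → (a ++ b) ≈M (b ++ a)
≈M-++-comm a b = ↭⇒≈M (++-comm a b)

≈M-++-identityʳ : ∀ a → (a ++ []) ≈M a
≈M-++-identityʳ a = ≡⇒≈M (++-identityʳ a)

≈M-shift : ∀ {β} a b → (a ++ β ∷ b) ≈M (β ∷ a ++ b)
≈M-shift a b = ↭⇒≈M (↭-shift a b)

≈M-drop-∷ : ∀ {β β' c c'} → (β ∷ c) ≈M (β' ∷ c') → β ≈D β' → c ≈M c'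
≈M-drop-∷ p e = ↭⇒≈M (dropMiddleElement [] [] (≈M⇒↭ (trans p (≈D-sym e ∷ ≈M-refl))))

≈M-split-++ : ∀ {δ c} a b → (δ ∷ c) ≈M (a ++ b) →
  (Σ MF λ a' → a ≈M (δ ∷ a') × c ≈M (a' ++ b)) ⊎
  (Σ MF λ b' → b ≈M (δ ∷ b') × c ≈M (a ++ b'))
≈M-split-++ a b p with ++⁻ a (∈-resp-↭ (≈M⇒↭ p) (here ≈D-refl))
... | inj₁ δ∈a with ∈-∃++ D-setoid δ∈a
...   | a₁ , a₂ , _ , δ≈γ , a≋ = inj₁ (a₁ ++ a₂ , a≈ , ≈M-drop-∷ (trans p (≈M-++⁺ a≈ ≈M-refl)) ≈D-refl)
  where
  a≈ = trans (↭⇒≈M (Perm.refl a≋)) (trans (≈M-shift a₁ a₂) (≈D-sym δ≈γ ∷ ≈M-refl))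
≈M-split-++ a b p | inj₂ δ∈b with ∈-∃++ D-setoid δ∈b
...   | b₁ , b₂ , _ , δ≈γ , b≋ = inj₂ (b₁ ++ b₂ , b≈ , ≈M-drop-∷ (trans p moved) ≈D-refl)
  where
  b≈ = trans (↭⇒≈M (Perm.refl b≋)) (trans (≈M-shift b₁ b₂) (≈D-sym δ≈γ ∷ ≈M-refl))
  moved = trans (≈M-++⁺ ≈M-refl b≈) (≈M-shift a (b₁ ++ b₂))

≈M-singleton⁻ : ∀ {δ δ' c} → (δ ∷ c) ≈M [ δ' ] → δ ≈D δ' × c ≈M []
≈M-singleton⁻ p with ∈-resp-↭ (≈M⇒↭ p) (here ≈D-refl)
... | here e = e , ≈M-drop-∷ p e

::-cong : ∀ {a a' α α'} → a ≈M a' → α ≈D α' → (a :: α) ≈D (a' :: α')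
::-cong {α = mk _} {mk _} p (mk q) = mk (p ∷ q)

::-injective : ∀ {a a' α α'} → (a :: α) ≈D (a' :: α') → (a ≈M a') × (α ≈D α')
::-injective {α = mk _} {mk _} (mk (p ∷ q)) = p , mk q

::≈*⁻ : ∀ {a α} → (a :: α) ≈D * → (a ≡ []) × (α ≈D *)
::≈*⁻ {α = mk _} (mk (nil-l p)) = refl , mk p

[]::≈* : ∀ {α} → α ≈D * → ([] :: α) ≈D *
[]::≈* {mk _} (mk p) = mk (nil-l p)

consTrim≈ : ∀ a as → consTrim a as ≈S (a ∷ as)
consTrim≈ [] [] = nil-r []
consTrim≈ [] (_ ∷ _) = ≈S-refl
consTrim≈ (_ ∷ _) _ = ≈S-refl

mutual
  norm≈ : ∀ α → norm α ≈D α
  norm≈ (mk as) = mk (normS≈ as)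

  normS≈ : ∀ as → normS as ≈S as
  normS≈ [] = []
  normS≈ (a ∷ as) = ≈S-trans (consTrim≈ (normM a) (normS as)) (normM≈ a ∷ normS≈ as)

  normM≈ : ∀ a → normM a ≈M a
  normM≈ [] = []
  normM≈ (α ∷ a) = norm≈ α ∷ normM≈ a

≈E-refl : ∀ {n} {a : Env n} → a ≈E a
≈E-refl = VecPW.refl ≈M-refl

≈E-sym : ∀ {n} {a b : Env n} → a ≈E b → b ≈E a
≈E-sym = VecPW.sym ≈M-sym

≈E-trans : ∀ {n} {a b c : Env n} → a ≈E b → b ≈E c → a ≈E c
≈E-trans = VecPW.trans trans

≡⇒≈E : ∀ {n} {a b : Env n} → a ≡ b → a ≈E b
≡⇒≈E refl = ≈E-refl

⊎E-cong : ∀ {n} {a a' b b' : Env n} → a ≈E a' → b ≈E b' → (a ⊎E b) ≈E (a' ⊎E b')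
⊎E-cong [] [] = []
⊎E-cong (p ∷ ps) (q ∷ qs) = ≈M-++⁺ p q ∷ ⊎E-cong ps qs

⊎E-comm : ∀ {n} (a b : Env n) → (a ⊎E b) ≈E (b ⊎E a)
⊎E-comm [] [] = []
⊎E-comm (x ∷ a) (y ∷ b) = ≈M-++-comm x y ∷ ⊎E-comm a b

⊎E-assoc : ∀ {n} (a b c : Env n) → ((a ⊎E b) ⊎E c) ≈E (a ⊎E (b ⊎E c))
⊎E-assoc [] [] [] = []
⊎E-assoc (x ∷ a) (y ∷ b) (z ∷ c) = ≡⇒≈M (++-assoc x y z) ∷ ⊎E-assoc a b c

⊎E-identityˡ : ∀ {n} (a : Env n) → (emptyE ⊎E a) ≈E a
⊎E-identityˡ [] = []
⊎E-identityˡ (x ∷ a) = ≈M-refl ∷ ⊎E-identityˡ a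

⊎E-identityʳ : ∀ {n} (a : Env n) → (a ⊎E emptyE) ≈E a
⊎E-identityʳ a = ≈E-trans (⊎E-comm a emptyE) (⊎E-identityˡ a)

⊎E-middle : ∀ {n} (a b c : Env n) → (a ⊎E (b ⊎E c)) ≈E (b ⊎E (a ⊎E c))
⊎E-middle a b c = ≈E-trans (≈E-sym (⊎E-assoc a b c))
  (≈E-trans (⊎E-cong (⊎E-comm a b) ≈E-refl) (⊎E-assoc b a c))

⊎E-swapʳ : ∀ {n} (a b c : Env n) → ((a ⊎E b) ⊎E c) ≈E ((a ⊎E c) ⊎E b)
⊎E-swapʳ a b c = ≈E-trans (⊎E-assoc a b c)
  (≈E-trans (⊎E-cong ≈E-refl (⊎E-comm b c)) (≈E-sym (⊎E-assoc a c b)))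

⊎E-regroupˡ : ∀ {n} {e a₁ a₂ d c : Env n} → e ≈E (a₁ ⊎E a₂) → a₁ ≈E (d ⊎E c) → e ≈E ((d ⊎E a₂) ⊎E c)
⊎E-regroupˡ {a₂ = a₂} {d} {c} p r = ≈E-trans p (≈E-trans (⊎E-cong r ≈E-refl) (⊎E-swapʳ d c a₂))

⊎E-regroupʳ : ∀ {n} {e a₁ a₂ d c : Env n} → e ≈E (a₁ ⊎E a₂) → a₂ ≈E (d ⊎E c) → e ≈E ((a₁ ⊎E d) ⊎E c)
⊎E-regroupʳ {a₁ = a₁} {d = d} {c} p r = ≈E-trans p (≈E-trans (⊎E-cong ≈E-refl r) (≈E-sym (⊎E-assoc a₁ d c)))

⊎E-regroupᵃ : ∀ {n} {e d c a₁ a₂ : Env n} → e ≈E (d ⊎E c) → d ≈E (a₁ ⊎E a₂) → e ≈E (a₁ ⊎E (a₂ ⊎E c))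
⊎E-regroupᵃ {c = c} {a₁} {a₂} r s = ≈E-trans r (≈E-trans (⊎E-cong s ≈E-refl) (⊎E-assoc a₁ a₂ c))

singleE-cong : ∀ {n} (i : Fin n) {α α'} → α ≈D α' → singleE i α ≈E singleE i α'
singleE-cong zero e = (e ∷ []) ∷ ≈E-refl
singleE-cong (suc i) e = [] ∷ singleE-cong i e

mutual
  Sem-resp : ∀ {n} {M : Term n} {a a' α α'} → Sem M a α → a ≈E a' → α ≈D α' → Sem M a' α'
  Sem-resp (s-var {i = i} p) q e = s-var (≈E-trans (≈E-sym q) (≈E-trans p (singleE-cong i e)))
  Sem-resp (s-lam s p) q e = s-lam (Sem-resp s (≈M-refl ∷ q) ≈D-refl) (≈D-trans (≈D-sym e) p)
  Sem-resp (s-app s b p) q e = s-app (Sem-resp s ≈E-refl (::-cong ≈M-refl e)) b (≈E-trans (≈E-sym q) p)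
  Sem-resp (s-tbar t p) q e = s-tbar (SemTest-resp t q) (≈D-trans (≈D-sym e) p)

  SemBag-resp : ∀ {n} {P : Bag n} {a a' b b'} → SemBag P a b → a ≈E a' → b ≈M b' → SemBag P a' b'
  SemBag-resp (b-nil p r) q e = b-nil (≈E-trans (≈E-sym q) p) (trans (≈M-sym e) r)
  SemBag-resp (b-cons s t p r) q e = b-cons s t (≈E-trans (≈E-sym q) p) (trans (≈M-sym e) r)

  SemTest-resp : ∀ {n} {V : Test n} {a a'} → SemTest V a → a ≈E a' → SemTest V a'
  SemTest-resp (t-nil p) q = t-nil (≈E-trans (≈E-sym q) p)
  SemTest-resp (t-cons s t p) q = t-cons s t (≈E-trans (≈E-sym q) p)

mutual
  ≃-refl : ∀ {n} {M : Term n} → M ≃ M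
  ≃-refl {M = var _} = var
  ≃-refl {M = lam _} = lam ≃-refl
  ≃-refl {M = app _ _} = app ≃-refl ≃L-refl
  ≃-refl {M = tbar _} = tbar ≃L-refl

  ≃L-refl : ∀ {n} {P : List (Term n)} → P ≃L P
  ≃L-refl {P = []} = []
  ≃L-refl {P = _ ∷ _} = ≃-refl ∷ ≃L-refl

mutual
  ≃-sym : ∀ {n} {M M' : Term n} → M ≃ M' → M' ≃ M
  ≃-sym var = var
  ≃-sym (lam p) = lam (≃-sym p)
  ≃-sym (app p q) = app (≃-sym p) (≃L-sym q)
  ≃-sym (tbar q) = tbar (≃L-sym q)

  ≃L-sym : ∀ {n} {P P' : List (Term n)} → P ≃L P' → P' ≃L P
  ≃L-sym [] = []
  ≃L-sym (p ∷ q) = ≃-sym p ∷ ≃L-sym q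
  ≃L-sym swap = swap
  ≃L-sym (trans p q) = trans (≃L-sym q) (≃L-sym p)

mutual
  Sem-≃ : ∀ {n} {M M' : Term n} {a α} → Sem M a α → M ≃ M' → Sem M' a α
  Sem-≃ s var = s
  Sem-≃ (s-lam s e) (lam p) = s-lam (Sem-≃ s p) e
  Sem-≃ (s-app s b e) (app p q) = s-app (Sem-≃ s p) (SemBag-≃ b q) e
  Sem-≃ (s-tbar t e) (tbar q) = s-tbar (SemTest-≃ t q) e

  SemBag-≃ : ∀ {n} {P P' : Bag n} {a b} → SemBag P a b → P ≃L P' → SemBag P' a b
  SemBag-≃ s [] = s
  SemBag-≃ (b-cons s t e r) (p ∷ q) = b-cons (Sem-≃ s p) (SemBag-≃ t q) e r
  SemBag-≃ (b-cons {a₁ = a₁} s₁ (b-cons {a₁ = a₂} {a₂ = a₃} s₂ t e₂ r₂) e₁ r₁) swap =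
    b-cons s₂ (b-cons s₁ t ≈E-refl ≈M-refl)
      (≈E-trans e₁ (≈E-trans (⊎E-cong ≈E-refl e₂) (⊎E-middle a₁ a₂ a₃)))
      (trans r₁ (trans (≈D-refl ∷ r₂) swap))
  SemBag-≃ s (trans p q) = SemBag-≃ (SemBag-≃ s p) q

  SemTest-≃ : ∀ {n} {V V' : Test n} {a} → SemTest V a → V ≃L V' → SemTest V' a
  SemTest-≃ s [] = s
  SemTest-≃ (t-cons s t e) (p ∷ q) = t-cons (Sem-≃ s p) (SemTest-≃ t q) e
  SemTest-≃ (t-cons {a₁ = a₁} s₁ (t-cons {a₁ = a₂} {a₂ = a₃} s₂ t e₂) e₁) swap =
    t-cons s₂ (t-cons s₁ t ≈E-refl)
      (≈E-trans e₁ (≈E-trans (⊎E-cong ≈E-refl e₂) (⊎E-middle a₁ a₂ a₃)))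
  SemTest-≃ s (trans p q) = SemTest-≃ (SemTest-≃ s p) q

SemTest-++⁺ : ∀ {n} (V W : Test n) {a b} → SemTest V a → SemTest W b → SemTest (V ++ W) (a ⊎E b)
SemTest-++⁺ [] W (t-nil p) t = SemTest-resp t (≈E-sym (≈E-trans (⊎E-cong p ≈E-refl) (⊎E-identityˡ _)))
SemTest-++⁺ (L ∷ V) W {b = b} (t-cons {a₁ = a₁} {a₂ = a₂} s t p) t' =
  t-cons s (SemTest-++⁺ V W t t') (≈E-trans (⊎E-cong p ≈E-refl) (⊎E-assoc a₁ a₂ b))

SemTest-++⁻ : ∀ {n} (V W : Test n) {c} → SemTest (V ++ W) c →
  Σ (Env n) λ a → Σ (Env n) λ b → SemTest V a × SemTest W b × c ≈E (a ⊎E b)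
SemTest-++⁻ [] W {c} t = emptyE , c , t-nil ≈E-refl , t , ≈E-sym (⊎E-identityˡ c)
SemTest-++⁻ (L ∷ V) W (t-cons {a₁ = a₁} s t p) with SemTest-++⁻ V W t
... | a , b , tV , tW , r =
  a₁ ⊎E a , b , t-cons s tV ≈E-refl , tW ,
  ≈E-trans p (≈E-trans (⊎E-cong ≈E-refl r) (≈E-sym (⊎E-assoc a₁ a b)))

addAt : ∀ {n} → Fin n → MF → Env n → Env n
addAt zero x (y ∷ e) = (x ++ y) ∷ e
addAt (suc j) x (y ∷ e) = y ∷ addAt j x e

pushE : ∀ {m k} → (Fin m → Fin k) → Env m → Env k
pushE ρ [] = emptyE
pushE ρ (x ∷ e) = addAt (ρ zero) x (pushE (λ i → ρ (suc i)) e)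

addAt-[] : ∀ {n} (j : Fin n) e → addAt j [] e ≡ e
addAt-[] zero (y ∷ e) = refl
addAt-[] (suc j) (y ∷ e) = cong (y ∷_) (addAt-[] j e)

addAt-cong : ∀ {n} (j : Fin n) {x x' e e'} → x ≈M x' → e ≈E e' → addAt j x e ≈E addAt j x' e'
addAt-cong zero p (q ∷ r) = ≈M-++⁺ p q ∷ r
addAt-cong (suc j) p (q ∷ r) = q ∷ addAt-cong j p r

addAt-addAt : ∀ {n} (j : Fin n) x y e → addAt j x (addAt j y e) ≡ addAt j (x ++ y) e
addAt-addAt zero x y (z ∷ e) = cong (_∷ e) (≡.sym (++-assoc x y z))
addAt-addAt (suc j) x y (z ∷ e) = cong (z ∷_) (addAt-addAt j x y e)

addAt-⊎ : ∀ {n} (j : Fin n) x y (c d : Env n) → addAt j (x ++ y) (c ⊎E d) ≈E (addAt j x c ⊎E addAt j y d)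
addAt-⊎ zero x y (c ∷ _) (d ∷ _) =
  trans (≡⇒≈M (++-assoc x y (c ++ d)))
    (trans (≈M-++⁺ (≈M-refl {x}) (↭⇒≈M (shifts y c))) (≡⇒≈M (≡.sym (++-assoc x c (y ++ d)))))
  ∷ ≈E-refl
addAt-⊎ (suc j) x y (c ∷ cs) (d ∷ ds) = ≈M-refl ∷ addAt-⊎ j x y cs ds

addAt-⊎ˡ : ∀ {n} (j : Fin n) x (d a : Env n) → addAt j x (d ⊎E a) ≈E (addAt j x d ⊎E a)
addAt-⊎ˡ j x d a = ≈E-trans (≡⇒≈E (cong (λ z → addAt j z (d ⊎E a)) (≡.sym (++-identityʳ x))))
  (≈E-trans (addAt-⊎ j x [] d a) (⊎E-cong ≈E-refl (≡⇒≈E (addAt-[] j a))))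

addAt-⊎ʳ : ∀ {n} (j : Fin n) x (a d : Env n) → addAt j x (a ⊎E d) ≈E (a ⊎E addAt j x d)
addAt-⊎ʳ j x a d = ≈E-trans (addAt-cong j ≈M-refl (⊎E-comm a d))
  (≈E-trans (addAt-⊎ˡ j x d a) (⊎E-comm _ a))

addAt-singleton : ∀ {n} (j : Fin n) α → addAt j [ α ] emptyE ≡ singleE j α
addAt-singleton zero α = refl
addAt-singleton (suc j) α = cong ([] ∷_) (addAt-singleton j α)

pushE-cong : ∀ {m k} (ρ : Fin m → Fin k) {e e'} → e ≈E e' → pushE ρ e ≈E pushE ρ e'
pushE-cong ρ [] = ≈E-refl
pushE-cong ρ (p ∷ q) = addAt-cong (ρ zero) p (pushE-cong _ q)

pushE-⊎ : ∀ {m k} (ρ : Fin m → Fin k) (a b : Env m) → pushE ρ (a ⊎E b) ≈E (pushE ρ a ⊎E pushE ρ b)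
pushE-⊎ ρ [] [] = ≈E-sym (⊎E-identityˡ emptyE)
pushE-⊎ ρ (x ∷ a) (y ∷ b) =
  ≈E-trans (addAt-cong (ρ zero) ≈M-refl (pushE-⊎ _ a b)) (addAt-⊎ (ρ zero) x y _ _)

pushE-empty : ∀ {m k} (ρ : Fin m → Fin k) → pushE ρ emptyE ≡ emptyE
pushE-empty {zero} ρ = refl
pushE-empty {suc m} ρ =
  ≡.trans (cong (addAt (ρ zero) []) (pushE-empty (λ i → ρ (suc i)))) (addAt-[] (ρ zero) emptyE)

pushE-singleE : ∀ {m k} (ρ : Fin m → Fin k) i α → pushE ρ (singleE i α) ≡ singleE (ρ i) α
pushE-singleE ρ zero α =
  ≡.trans (cong (addAt (ρ zero) [ α ]) (pushE-empty (λ i → ρ (suc i)))) (addAt-singleton (ρ zero) α)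
pushE-singleE ρ (suc i) α = ≡.trans (addAt-[] (ρ zero) _) (pushE-singleE _ i α)

pushE-suc : ∀ {m k} (ρ : Fin m → Fin k) e → pushE (λ i → suc (ρ i)) e ≡ [] ∷ pushE ρ e
pushE-suc ρ [] = refl
pushE-suc ρ (x ∷ e) = cong (addAt (suc (ρ zero)) x) (pushE-suc _ e)

pushE-ext : ∀ {m k} (ρ : Fin m → Fin k) b e → pushE (ext ρ) (b ∷ e) ≈E (b ∷ pushE ρ e)
pushE-ext ρ b e = ≡⇒≈E
  (≡.trans (cong (addAt zero b) (pushE-suc ρ e)) (cong (_∷ pushE ρ e) (++-identityʳ b)))

pushE-id : ∀ {m} (e : Env m) → pushE (λ i → i) e ≈E e
pushE-id [] = []
pushE-id (x ∷ e) =
  ≈E-trans (≡⇒≈E (cong (addAt zero x) (pushE-suc (λ i → i) e))) (≈M-++-identityʳ x ∷ pushE-id e)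

pushE-weaken : ∀ {m} (e : Env m) → pushE suc e ≈E ([] ∷ e)
pushE-weaken e = ≈E-trans (≡⇒≈E (pushE-suc (λ i → i) e)) (≈M-refl ∷ pushE-id e)

mutual
  Sem-ren⁺ : ∀ {m k} (ρ : Fin m → Fin k) {M e α} → Sem M e α → Sem (ren ρ M) (pushE ρ e) α
  Sem-ren⁺ ρ (s-var {i = i} {α = α} p) = s-var (≈E-trans (pushE-cong ρ p) (≡⇒≈E (pushE-singleE ρ i α)))
  Sem-ren⁺ ρ (s-lam {a = e} {b = b} s q) = s-lam (Sem-resp (Sem-ren⁺ (ext ρ) s) (pushE-ext ρ b e) ≈D-refl) q
  Sem-ren⁺ ρ (s-app {a₁ = a₁} {a₂ = a₂} s b p) =
    s-app (Sem-ren⁺ ρ s) (SemBag-ren⁺ ρ b) (≈E-trans (pushE-cong ρ p) (pushE-⊎ ρ a₁ a₂))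
  Sem-ren⁺ ρ (s-tbar t q) = s-tbar (SemTest-ren⁺ ρ t) q

  SemBag-ren⁺ : ∀ {m k} (ρ : Fin m → Fin k) {P e b} → SemBag P e b → SemBag (renL ρ P) (pushE ρ e) b
  SemBag-ren⁺ ρ (b-nil p q) = b-nil (≈E-trans (pushE-cong ρ p) (≡⇒≈E (pushE-empty ρ))) q
  SemBag-ren⁺ ρ (b-cons {a₁ = a₁} {a₂ = a₂} s t p q) =
    b-cons (Sem-ren⁺ ρ s) (SemBag-ren⁺ ρ t) (≈E-trans (pushE-cong ρ p) (pushE-⊎ ρ a₁ a₂)) q

  SemTest-ren⁺ : ∀ {m k} (ρ : Fin m → Fin k) {V e} → SemTest V e → SemTest (renL ρ V) (pushE ρ e)
  SemTest-ren⁺ ρ (t-nil p) = t-nil (≈E-trans (pushE-cong ρ p) (≡⇒≈E (pushE-empty ρ)))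
  SemTest-ren⁺ ρ (t-cons {a₁ = a₁} {a₂ = a₂} s t p) =
    t-cons (Sem-ren⁺ ρ s) (SemTest-ren⁺ ρ t) (≈E-trans (pushE-cong ρ p) (pushE-⊎ ρ a₁ a₂))

mutual
  Sem-ren⁻ : ∀ {m k} (ρ : Fin m → Fin k) (M : Term m) {e' α} → Sem (ren ρ M) e' α →
    Σ (Env m) λ e → Sem M e α × e' ≈E pushE ρ e
  Sem-ren⁻ ρ (var i) (s-var {α = α} p) =
    singleE i α , s-var ≈E-refl , ≈E-trans p (≡⇒≈E (≡.sym (pushE-singleE ρ i α)))
  Sem-ren⁻ ρ (lam M) (s-lam s q) with Sem-ren⁻ (ext ρ) M s
  ... | c ∷ e , s' , r with ≈E-trans r (pushE-ext ρ c e)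
  ...   | r₀ ∷ rs = e , s-lam s' (≈D-trans q (::-cong r₀ ≈D-refl)) , rs
  Sem-ren⁻ ρ (app M P) (s-app s b p) with Sem-ren⁻ ρ M s | SemBag-ren⁻ ρ P b
  ... | e₁ , s₁ , r₁ | e₂ , s₂ , r₂ =
    e₁ ⊎E e₂ , s-app s₁ s₂ ≈E-refl , ≈E-trans p (≈E-trans (⊎E-cong r₁ r₂) (≈E-sym (pushE-⊎ ρ e₁ e₂)))
  Sem-ren⁻ ρ (tbar V) (s-tbar t q) with SemTest-ren⁻ ρ V t
  ... | e , t' , r = e , s-tbar t' q , r

  SemBag-ren⁻ : ∀ {m k} (ρ : Fin m → Fin k) (P : Bag m) {e' b} → SemBag (renL ρ P) e' b →
    Σ (Env m) λ e → SemBag P e b × e' ≈E pushE ρ e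
  SemBag-ren⁻ ρ [] (b-nil p q) = emptyE , b-nil ≈E-refl q , ≈E-trans p (≡⇒≈E (≡.sym (pushE-empty ρ)))
  SemBag-ren⁻ ρ (L ∷ P) (b-cons s t p q) with Sem-ren⁻ ρ L s | SemBag-ren⁻ ρ P t
  ... | e₁ , s₁ , r₁ | e₂ , s₂ , r₂ =
    e₁ ⊎E e₂ , b-cons s₁ s₂ ≈E-refl q , ≈E-trans p (≈E-trans (⊎E-cong r₁ r₂) (≈E-sym (pushE-⊎ ρ e₁ e₂)))

  SemTest-ren⁻ : ∀ {m k} (ρ : Fin m → Fin k) (V : Test m) {e'} → SemTest (renL ρ V) e' →
    Σ (Env m) λ e → SemTest V e × e' ≈E pushE ρ e
  SemTest-ren⁻ ρ [] (t-nil p) = emptyE , t-nil ≈E-refl , ≈E-trans p (≡⇒≈E (≡.sym (pushE-empty ρ)))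
  SemTest-ren⁻ ρ (L ∷ V) (t-cons s t p) with Sem-ren⁻ ρ L s | SemTest-ren⁻ ρ V t
  ... | e₁ , s₁ , r₁ | e₂ , s₂ , r₂ =
    e₁ ⊎E e₂ , t-cons s₁ s₂ ≈E-refl , ≈E-trans p (≈E-trans (⊎E-cong r₁ r₂) (≈E-sym (pushE-⊎ ρ e₁ e₂)))

Sem-weaken⁺ : ∀ {m} {M : Term m} {e α} → Sem M e α → Sem (ren suc M) ([] ∷ e) α
Sem-weaken⁺ s = Sem-resp (Sem-ren⁺ suc s) (pushE-weaken _) ≈D-refl

Sem-weaken⁻ : ∀ {m} (M : Term m) {b e α} → Sem (ren suc M) (b ∷ e) α → (b ≈M []) × Sem M e α
Sem-weaken⁻ M s with Sem-ren⁻ suc M s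
... | e , s' , r with ≈E-trans r (pushE-weaken e)
...   | p ∷ q = p , Sem-resp s' (≈E-sym q) ≈D-refl

SemBag-weaken⁺ : ∀ {m} {P : Bag m} {e b} → SemBag P e b → SemBag (renL suc P) ([] ∷ e) b
SemBag-weaken⁺ s = SemBag-resp (SemBag-ren⁺ suc s) (pushE-weaken _) ≈M-refl

SemBag-weaken⁻ : ∀ {m} (P : Bag m) {c e b} → SemBag (renL suc P) (c ∷ e) b → (c ≈M []) × SemBag P e b
SemBag-weaken⁻ P s with SemBag-ren⁻ suc P s
... | e , s' , r with ≈E-trans r (pushE-weaken e)
...   | p ∷ q = p , SemBag-resp s' (≈E-sym q) ≈M-refl

occVar : ∀ {n} → Fin n → Fin n → ℕ
occVar zero zero = 1
occVar zero (suc j) = 0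
occVar (suc i) zero = 0
occVar (suc i) (suc j) = occVar i j

occVar-refl : ∀ {n} (i : Fin n) → occVar i i ≡ 1
occVar-refl zero = refl
occVar-refl (suc i) = occVar-refl i

occVar-≢ : ∀ {n} {i j : Fin n} → i ≢ j → occVar i j ≡ 0
occVar-≢ {i = zero} {zero} i≢j = ⊥-elim (i≢j refl)
occVar-≢ {i = zero} {suc j} _ = refl
occVar-≢ {i = suc i} {zero} _ = refl
occVar-≢ {i = suc i} {suc j} i≢j = occVar-≢ (λ e → i≢j (cong suc e))

mutual
  occ : ∀ {n} → Fin n → Term n → ℕ
  occ i (var j) = occVar i j
  occ i (lam M) = occ (suc i) M
  occ i (app M P) = occ i M + occL i P
  occ i (tbar V) = occL i V

  occL : ∀ {n} → Fin n → List (Term n) → ℕ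
  occL i [] = 0
  occL i (L ∷ P) = occ i L + occL i P

length-≈E : ∀ {n} {e e' : Env n} → e ≈E e' → ∀ i → length (lookup e i) ≡ length (lookup e' i)
length-≈E p i = ≈M-length (VecPW.lookup p i)

length-emptyE : ∀ {n} (i : Fin n) → length (lookup (emptyE {n}) i) ≡ 0
length-emptyE zero = refl
length-emptyE (suc i) = length-emptyE i

length-singleE : ∀ {n} (i j : Fin n) α → length (lookup (singleE j α) i) ≡ occVar i j
length-singleE zero zero α = refl
length-singleE zero (suc j) α = refl
length-singleE (suc i) zero α = length-emptyE i
length-singleE (suc i) (suc j) α = length-singleE i j α

length-⊎E : ∀ {n} (a b : Env n) i → length (lookup (a ⊎E b) i) ≡ length (lookup a i) + length (lookup b i)
length-⊎E (x ∷ a) (y ∷ b) zero = length-++ x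
length-⊎E (x ∷ a) (y ∷ b) (suc i) = length-⊎E a b i

mutual
  Sem-linear : ∀ {n} {M : Term n} {e α} → Sem M e α → ∀ i → occ i M ≡ length (lookup e i)
  Sem-linear (s-var {i = j} {α = α} p) i = ≡.sym (≡.trans (length-≈E p i) (length-singleE i j α))
  Sem-linear (s-lam s _) i = Sem-linear s (suc i)
  Sem-linear (s-app {a₁ = a₁} {a₂ = a₂} s b p) i =
    ≡.trans (cong₂ _+_ (Sem-linear s i) (SemBag-linear b i))
      (≡.sym (≡.trans (length-≈E p i) (length-⊎E a₁ a₂ i)))
  Sem-linear (s-tbar t _) i = SemTest-linear t i

  SemBag-linear : ∀ {n} {P : Bag n} {e b} → SemBag P e b → ∀ i → occL i P ≡ length (lookup e i)
  SemBag-linear (b-nil p _) i = ≡.sym (≡.trans (length-≈E p i) (length-emptyE i))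
  SemBag-linear (b-cons {a₁ = a₁} {a₂ = a₂} s t p _) i =
    ≡.trans (cong₂ _+_ (Sem-linear s i) (SemBag-linear t i))
      (≡.sym (≡.trans (length-≈E p i) (length-⊎E a₁ a₂ i)))

  SemTest-linear : ∀ {n} {V : Test n} {e} → SemTest V e → ∀ i → occL i V ≡ length (lookup e i)
  SemTest-linear (t-nil p) i = ≡.sym (≡.trans (length-≈E p i) (length-emptyE i))
  SemTest-linear (t-cons {a₁ = a₁} {a₂ = a₂} s t p) i =
    ≡.trans (cong₂ _+_ (Sem-linear s i) (SemTest-linear t i))
      (≡.sym (≡.trans (length-≈E p i) (length-⊎E a₁ a₂ i)))

mutual
  ren-cong : ∀ {m k} {ρ σ : Fin m → Fin k} → (∀ x → ρ x ≡ σ x) → ∀ M → ren ρ M ≡ ren σ M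
  ren-cong h (var x) = cong var (h x)
  ren-cong h (lam M) = cong lam (ren-cong (ext-cong h) M)
  ren-cong h (app M P) = cong₂ app (ren-cong h M) (renL-cong h P)
  ren-cong h (tbar V) = cong tbar (renL-cong h V)

  renL-cong : ∀ {m k} {ρ σ : Fin m → Fin k} → (∀ x → ρ x ≡ σ x) → ∀ P → renL ρ P ≡ renL σ P
  renL-cong h [] = refl
  renL-cong h (L ∷ P) = cong₂ _∷_ (ren-cong h L) (renL-cong h P)

  ext-cong : ∀ {m k} {ρ σ : Fin m → Fin k} → (∀ x → ρ x ≡ σ x) → ∀ x → ext ρ x ≡ ext σ x
  ext-cong h zero = refl
  ext-cong h (suc x) = cong suc (h x)

ext-punchIn : ∀ {m} (i : Fin (suc m)) x → ext (punchIn i) x ≡ punchIn (suc i) x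
ext-punchIn i zero = refl
ext-punchIn i (suc x) = refl

mutual
  str-ren : ∀ {m} (i : Fin (suc m)) M {M'} → str i M ≡ just M' → M ≡ ren (punchIn i) M'
  str-ren i (var j) eq with i ≟ j
  str-ren i (var j) () | yes _
  str-ren i (var j) refl | no i≢j = cong var (≡.sym (punchIn-punchOut i≢j))
  str-ren i (lam M) eq with str (suc i) M in e
  str-ren i (lam M) refl | just M' =
    cong lam (≡.trans (str-ren (suc i) M e) (≡.sym (ren-cong (ext-punchIn i) M')))
  str-ren i (lam M) () | nothing
  str-ren i (app M P) eq with str i M in e₁ | strL i P in e₂
  str-ren i (app M P) refl | just _ | just _ = cong₂ app (str-ren i M e₁) (strL-ren i P e₂)
  str-ren i (app M P) () | just _ | nothing
  str-ren i (app M P) () | nothing | _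
  str-ren i (tbar V) eq with strL i V in e
  str-ren i (tbar V) refl | just _ = cong tbar (strL-ren i V e)
  str-ren i (tbar V) () | nothing

  strL-ren : ∀ {m} (i : Fin (suc m)) P {P'} → strL i P ≡ just P' → P ≡ renL (punchIn i) P'
  strL-ren i [] refl = refl
  strL-ren i (L ∷ P) eq with str i L in e₁ | strL i P in e₂
  strL-ren i (L ∷ P) refl | just _ | just _ = cong₂ _∷_ (str-ren i L e₁) (strL-ren i P e₂)
  strL-ren i (L ∷ P) () | just _ | nothing
  strL-ren i (L ∷ P) () | nothing | _

mutual
  str-occ : ∀ {m} (i : Fin (suc m)) M → occ i M ≡ 0 → Σ (Term m) λ M' → str i M ≡ just M'
  str-occ i (var j) o with i ≟ j
  ... | yes refl with ≡.trans (≡.sym (occVar-refl i)) o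
  ...   | ()
  str-occ i (var j) o | no _ = _ , refl
  str-occ i (lam M) o with str (suc i) M | str-occ (suc i) M o
  ... | just _ | _ = _ , refl
  ... | nothing | _ , ()
  str-occ i (app M P) o with str i M | strL i P
                           | str-occ i M (m+n≡0⇒m≡0 (occ i M) o) | strL-occ i P (m+n≡0⇒n≡0 (occ i M) o)
  ... | just _ | just _ | _ | _ = _ , refl
  ... | nothing | _ | _ , () | _
  ... | just _ | nothing | _ | _ , ()
  str-occ i (tbar V) o with strL i V | strL-occ i V o
  ... | just _ | _ = _ , refl
  ... | nothing | _ , ()

  strL-occ : ∀ {m} (i : Fin (suc m)) P → occL i P ≡ 0 → Σ (List (Term m)) λ P' → strL i P ≡ just P'
  strL-occ i [] o = _ , refl
  strL-occ i (L ∷ P) o with str i L | strL i P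
                           | str-occ i L (m+n≡0⇒m≡0 (occ i L) o) | strL-occ i P (m+n≡0⇒n≡0 (occ i L) o)
  ... | just _ | just _ | _ | _ = _ , refl
  ... | nothing | _ | _ , () | _
  ... | just _ | nothing | _ | _ , ()

SemΣ : ∀ {n} → Sum (Term n) → Env n → D → Set
SemΣ S e α = Any (λ t → Sem t e α) S

SemBagΣ : ∀ {n} → Sum (Bag n) → Env n → MF → Set
SemBagΣ S e b = Any (λ P → SemBag P e b) S

SemTestΣ : ∀ {n} → Sum (Test n) → Env n → Set
SemTestΣ S e = Any (λ V → SemTest V e) S

SemΣ-resp : ∀ {n} {S : Sum (Term n)} {e e' α} → SemΣ S e α → e ≈E e' → SemΣ S e' α
SemΣ-resp s p = Any.map (λ t → Sem-resp t p ≈D-refl) s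

zeroSub-Sem⁺ : ∀ {m} (M : Term (suc m)) {e α} → Sem M ([] ∷ e) α → SemΣ (zeroSub M) e α
zeroSub-Sem⁺ M s with str zero M in eq
... | just M' = here (proj₂ (Sem-weaken⁻ M' (subst (λ z → Sem z _ _) (str-ren zero M eq) s)))
... | nothing with str-occ zero M (Sem-linear s zero)
...   | _ , eq' with ≡.trans (≡.sym eq) eq'
...     | ()

zeroSub-Sem⁻ : ∀ {m} (M : Term (suc m)) {e α} → SemΣ (zeroSub M) e α → Sem M ([] ∷ e) α
zeroSub-Sem⁻ M s with str zero M in eq
zeroSub-Sem⁻ M (here s) | just M' = subst (λ z → Sem z _ _) (≡.sym (str-ren zero M eq)) (Sem-weaken⁺ s)
zeroSub-Sem⁻ M () | nothing

-- The linear substitution lemma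

-- The points of ⟦R⟨N/x⟩⟧: the environment splits as d ⊎ eN with (eN , δ) ∈ ⟦N⟧, and R holds
-- at d extended by δ at x.
LinSplit : ∀ {n} → (Env n → Set) → Fin n → Term n → Env n → Set
LinSplit {n} R x N e = Σ (Env n) λ d → Σ D λ δ → Σ (Env n) λ eN →
  R (addAt x [ δ ] d) × Sem N eN δ × e ≈E (d ⊎E eN)

addAt-singleton≈singleE : ∀ {n} (x : Fin n) {δ α d} → addAt x [ δ ] d ≈E singleE x α → δ ≈D α × d ≈E emptyE
addAt-singleton≈singleE zero {d = _ ∷ _} (p ∷ q) with ≈M-singleton⁻ p
... | e , r = e , r ∷ q
addAt-singleton≈singleE (suc x) {d = _ ∷ _} (p ∷ q) with addAt-singleton≈singleE x q
... | e , r = e , p ∷ r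

length-addAt : ∀ {n} (x : Fin n) u d → length (lookup (addAt x u d) x) ≡ length u + length (lookup d x)
length-addAt zero u (_ ∷ _) = length-++ u
length-addAt (suc x) u (_ ∷ d) = length-addAt x u d

addAt-singleton≉singleE : ∀ {n} {x y : Fin n} {δ α d} → x ≢ y → ¬ (addAt x [ δ ] d ≈E singleE y α)
addAt-singleton≉singleE {x = x} {y} {δ} {α} {d} x≢y p
  with ≡.trans (≡.sym (length-addAt x [ δ ] d))
    (≡.trans (length-≈E p x) (≡.trans (length-singleE x y α) (occVar-≢ x≢y)))
... | ()

addAt-singleton≉emptyE : ∀ {n} (x : Fin n) {δ d} → ¬ (addAt x [ δ ] d ≈E emptyE)
addAt-singleton≉emptyE x {δ} {d} p with ≡.trans (≡.sym (length-addAt x [ δ ] d))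
  (≡.trans (length-≈E p x) (length-emptyE x))
... | ()

addAt-split : ∀ {n} (x : Fin n) {δ} d a₁ a₂ → addAt x [ δ ] d ≈E (a₁ ⊎E a₂) →
  (Σ (Env n) λ a₁' → a₁ ≈E addAt x [ δ ] a₁' × d ≈E (a₁' ⊎E a₂)) ⊎
  (Σ (Env n) λ a₂' → a₂ ≈E addAt x [ δ ] a₂' × d ≈E (a₁ ⊎E a₂'))
addAt-split zero (_ ∷ _) (u ∷ a₁) (v ∷ a₂) (p ∷ q) with ≈M-split-++ u v p
... | inj₁ (u' , r , s) = inj₁ (u' ∷ a₁ , r ∷ ≈E-refl , s ∷ q)
... | inj₂ (v' , r , s) = inj₂ (v' ∷ a₂ , r ∷ ≈E-refl , s ∷ q)
addAt-split (suc x) (_ ∷ d) (u ∷ a₁) (v ∷ a₂) (p ∷ q) with addAt-split x d a₁ a₂ q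
... | inj₁ (a₁' , r , s) = inj₁ (u ∷ a₁' , ≈M-refl ∷ r , p ∷ s)
... | inj₂ (a₂' , r , s) = inj₂ (v ∷ a₂' , ≈M-refl ∷ r , p ∷ s)

mutual
  lsub-Sem⁻ : ∀ {n} (M : Term n) x N {e α} → SemΣ (lsub M x N) e α → LinSplit (λ d → Sem M d α) x N e
  lsub-Sem⁻ (var y) x N s with x ≟ y
  lsub-Sem⁻ (var y) x N {e} {α} (here s) | yes refl =
    emptyE , α , e , s-var (≡⇒≈E (addAt-singleton x α)) , s , ≈E-sym (⊎E-identityˡ e)
  lsub-Sem⁻ (var y) x N () | no _
  lsub-Sem⁻ (lam M) x N s with find (map⁻ s)
  ... | _ , t∈ , s-lam sM q with lsub-Sem⁻ M (suc x) (ren suc N) (lose t∈ sM)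
  ...   | b ∷ d , δ , c ∷ eN , sM' , sN' , r ∷ rs with Sem-weaken⁻ N sN'
  ...     | c≈[] , sN =
    d , δ , eN , s-lam sM'
      (≈D-trans q (::-cong (trans r (trans (≈M-++⁺ ≈M-refl c≈[]) (≈M-++-identityʳ b))) ≈D-refl)) ,
    sN , rs
  lsub-Sem⁻ (app M P) x N s with ++⁻ (map (λ M' → app M' P) (lsub M x N)) s
  ... | inj₁ s₁ with find (map⁻ s₁)
  ...   | _ , t∈ , s-app {a₂ = a₂} sM sP p with lsub-Sem⁻ M x N (lose t∈ sM)
  ...     | d , δ , eN , sM' , sN , r =
    d ⊎E a₂ , δ , eN , s-app sM' sP (addAt-⊎ˡ x [ δ ] d a₂) , sN , ⊎E-regroupˡ p r
  lsub-Sem⁻ (app M P) x N s | inj₂ s₂ with find (map⁻ s₂)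
  ...   | _ , Q∈ , s-app {a₁ = a₁} sM sQ p with lsubL-SemBag⁻ P x N (lose Q∈ sQ)
  ...     | d , δ , eN , sP' , sN , r =
    a₁ ⊎E d , δ , eN , s-app sM sP' (addAt-⊎ʳ x [ δ ] a₁ d) , sN , ⊎E-regroupʳ p r
  lsub-Sem⁻ (tbar V) x N s with find (map⁻ s)
  ... | _ , W∈ , s-tbar t q with lsubL-SemTest⁻ V x N (lose W∈ t)
  ...   | d , δ , eN , sV , sN , r = d , δ , eN , s-tbar sV q , sN , r

  lsubL-SemBag⁻ : ∀ {n} (P : Bag n) x N {e b} → SemBagΣ (lsubL P x N) e b →
    LinSplit (λ d → SemBag P d b) x N e
  lsubL-SemBag⁻ [] x N ()
  lsubL-SemBag⁻ (L ∷ P) x N s with ++⁻ (map (_∷ P) (lsub L x N)) s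
  ... | inj₁ s₁ with find (map⁻ s₁)
  ...   | _ , t∈ , b-cons {a₂ = a₂} sL sP p q with lsub-Sem⁻ L x N (lose t∈ sL)
  ...     | d , δ , eN , sL' , sN , r =
    d ⊎E a₂ , δ , eN , b-cons sL' sP (addAt-⊎ˡ x [ δ ] d a₂) q , sN , ⊎E-regroupˡ p r
  lsubL-SemBag⁻ (L ∷ P) x N s | inj₂ s₂ with find (map⁻ s₂)
  ...   | _ , Q∈ , b-cons {a₁ = a₁} sL sQ p q with lsubL-SemBag⁻ P x N (lose Q∈ sQ)
  ...     | d , δ , eN , sP' , sN , r =
    a₁ ⊎E d , δ , eN , b-cons sL sP' (addAt-⊎ʳ x [ δ ] a₁ d) q , sN , ⊎E-regroupʳ p r

  lsubL-SemTest⁻ : ∀ {n} (V : Test n) x N {e} → SemTestΣ (lsubL V x N) e → LinSplit (SemTest V) x N e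
  lsubL-SemTest⁻ [] x N ()
  lsubL-SemTest⁻ (L ∷ V) x N s with ++⁻ (map (_∷ V) (lsub L x N)) s
  ... | inj₁ s₁ with find (map⁻ s₁)
  ...   | _ , t∈ , t-cons {a₂ = a₂} sL sV p with lsub-Sem⁻ L x N (lose t∈ sL)
  ...     | d , δ , eN , sL' , sN , r =
    d ⊎E a₂ , δ , eN , t-cons sL' sV (addAt-⊎ˡ x [ δ ] d a₂) , sN , ⊎E-regroupˡ p r
  lsubL-SemTest⁻ (L ∷ V) x N s | inj₂ s₂ with find (map⁻ s₂)
  ...   | _ , W∈ , t-cons {a₁ = a₁} sL sW p with lsubL-SemTest⁻ V x N (lose W∈ sW)
  ...     | d , δ , eN , sV' , sN , r =
    a₁ ⊎E d , δ , eN , t-cons sL sV' (addAt-⊎ʳ x [ δ ] a₁ d) , sN , ⊎E-regroupʳ p r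

mutual
  lsub-Sem⁺ : ∀ {n} (M : Term n) x N {e α} → LinSplit (λ d → Sem M d α) x N e → SemΣ (lsub M x N) e α
  lsub-Sem⁺ (var y) x N s with x ≟ y
  lsub-Sem⁺ (var y) x N (d , δ , eN , s-var p , sN , r) | yes refl with addAt-singleton≈singleE x p
  ... | δ≈α , d≈∅ =
    here (Sem-resp sN (≈E-sym (≈E-trans r (≈E-trans (⊎E-cong d≈∅ ≈E-refl) (⊎E-identityˡ eN)))) δ≈α)
  lsub-Sem⁺ (var y) x N (_ , _ , _ , s-var p , _) | no x≢y = ⊥-elim (addAt-singleton≉singleE x≢y p)
  lsub-Sem⁺ (lam M) x N (d , δ , eN , s-lam {b = b} sM q , sN , r) =
    map⁺ (Any.map (λ s → s-lam s q)
      (lsub-Sem⁺ M (suc x) (ren suc N)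
        (b ∷ d , δ , [] ∷ eN , sM , Sem-weaken⁺ sN , ≈M-sym (≈M-++-identityʳ b) ∷ r)))
  lsub-Sem⁺ (app M P) x N (d , δ , eN , s-app {a₁ = a₁} {a₂ = a₂} sM sP p , sN , r)
    with addAt-split x d a₁ a₂ p
  ... | inj₁ (a₁' , r₁ , s₁) =
    ++⁺ˡ (map⁺ (Any.map (λ s → s-app s sP (⊎E-regroupˡ r s₁))
      (lsub-Sem⁺ M x N (a₁' , δ , eN , Sem-resp sM r₁ ≈D-refl , sN , ≈E-refl))))
  ... | inj₂ (a₂' , r₂ , s₂) =
    ++⁺ʳ _ (map⁺ (Any.map (λ s → s-app sM s (⊎E-regroupᵃ r s₂))
      (lsubL-SemBag⁺ P x N (a₂' , δ , eN , SemBag-resp sP r₂ ≈M-refl , sN , ≈E-refl))))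
  lsub-Sem⁺ (tbar V) x N (d , δ , eN , s-tbar t q , sN , r) =
    map⁺ (Any.map (λ s → s-tbar s q) (lsubL-SemTest⁺ V x N (d , δ , eN , t , sN , r)))

  lsubL-SemBag⁺ : ∀ {n} (P : Bag n) x N {e b} → LinSplit (λ d → SemBag P d b) x N e →
    SemBagΣ (lsubL P x N) e b
  lsubL-SemBag⁺ [] x N (_ , _ , _ , b-nil p _ , _) = ⊥-elim (addAt-singleton≉emptyE x p)
  lsubL-SemBag⁺ (L ∷ P) x N (d , δ , eN , b-cons {a₁ = a₁} {a₂ = a₂} sL sP p q , sN , r)
    with addAt-split x d a₁ a₂ p
  ... | inj₁ (a₁' , r₁ , s₁) =
    ++⁺ˡ (map⁺ (Any.map (λ s → b-cons s sP (⊎E-regroupˡ r s₁) q)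
      (lsub-Sem⁺ L x N (a₁' , δ , eN , Sem-resp sL r₁ ≈D-refl , sN , ≈E-refl))))
  ... | inj₂ (a₂' , r₂ , s₂) =
    ++⁺ʳ _ (map⁺ (Any.map (λ s → b-cons sL s (⊎E-regroupᵃ r s₂) q)
      (lsubL-SemBag⁺ P x N (a₂' , δ , eN , SemBag-resp sP r₂ ≈M-refl , sN , ≈E-refl))))

  lsubL-SemTest⁺ : ∀ {n} (V : Test n) x N {e} → LinSplit (SemTest V) x N e → SemTestΣ (lsubL V x N) e
  lsubL-SemTest⁺ [] x N (_ , _ , _ , t-nil p , _) = ⊥-elim (addAt-singleton≉emptyE x p)
  lsubL-SemTest⁺ (L ∷ V) x N (d , δ , eN , t-cons {a₁ = a₁} {a₂ = a₂} sL sV p , sN , r)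
    with addAt-split x d a₁ a₂ p
  ... | inj₁ (a₁' , r₁ , s₁) =
    ++⁺ˡ (map⁺ (Any.map (λ s → t-cons s sV (⊎E-regroupˡ r s₁))
      (lsub-Sem⁺ L x N (a₁' , δ , eN , Sem-resp sL r₁ ≈D-refl , sN , ≈E-refl))))
  ... | inj₂ (a₂' , r₂ , s₂) =
    ++⁺ʳ _ (map⁺ (Any.map (λ s → t-cons sL s (⊎E-regroupᵃ r s₂))
      (lsubL-SemTest⁺ V x N (a₂' , δ , eN , SemTest-resp sV r₂ , sN , ≈E-refl))))

lsubΣ-Sem⁻ : ∀ {n} (S : Sum (Term n)) x N {e α} → SemΣ (lsubΣ S x N) e α → LinSplit (λ d → SemΣ S d α) x N e
lsubΣ-Sem⁻ S x N s with find (concatMap⁻ (λ A → lsub A x N) {xs = S} s)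
... | M , M∈ , sM with lsub-Sem⁻ M x N sM
...   | d , δ , eN , sM' , sN , r = d , δ , eN , lose M∈ sM' , sN , r

lsubΣ-Sem⁺ : ∀ {n} (S : Sum (Term n)) x N {e α} → LinSplit (λ d → SemΣ S d α) x N e → SemΣ (lsubΣ S x N) e α
lsubΣ-Sem⁺ S x N (d , δ , eN , s , sN , r) with find s
... | M , M∈ , sM =
  concatMap⁺ (λ A → lsub A x N) {xs = S} (lose M∈ (lsub-Sem⁺ M x N (d , δ , eN , sM , sN , r)))

BagSplit : ∀ {n} → (Env n → Set) → Fin n → Bag n → Env n → Set
BagSplit {n} R x P e =
  Σ (Env n) λ d → Σ MF λ b → Σ (Env n) λ eP → R (addAt x b d) × SemBag P eP b × e ≈E (d ⊎E eP)

addAt-extract : ∀ {n} (x : Fin n) b (d d' eL : Env n) → length (lookup eL x) ≡ 0 →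
  addAt x b d ≈E (d' ⊎E eL) → Σ (Env n) λ d'' → d' ≈E addAt x b d'' × d ≈E (d'' ⊎E eL)
addAt-extract zero b (y ∷ d) (y' ∷ d') ([] ∷ eL) refl (p ∷ q) =
  y ∷ d' , trans (≈M-sym (≈M-++-identityʳ y')) (≈M-sym p) ∷ ≈E-refl , ≈M-sym (≈M-++-identityʳ y) ∷ q
addAt-extract (suc x) b (y ∷ d) (y' ∷ d') (_ ∷ eL) o (p ∷ q) with addAt-extract x b d d' eL o q
... | d'' , r , s = y' ∷ d'' , ≈M-refl ∷ r , p ∷ s

lsubBag-Sem⁻ : ∀ {n} (S : Sum (Term n)) x (P : Bag n) → All (λ L → occ x L ≡ 0) P →
  ∀ {e α} → SemΣ (lsubBag S x P) e α → BagSplit (λ d → SemΣ S d α) x P e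
lsubBag-Sem⁻ S x [] [] {e} s =
  e , [] , emptyE , Any.map (λ t → Sem-resp t (≡⇒≈E (≡.sym (addAt-[] x e))) ≈D-refl) s ,
  b-nil ≈E-refl [] , ≈E-sym (⊎E-identityʳ e)
lsubBag-Sem⁻ S x (L ∷ P) (o ∷ os) s with lsubBag-Sem⁻ (lsubΣ S x L) x P os s
... | d , b , eP , s₁ , sP , r with lsubΣ-Sem⁻ S x L s₁
...   | d' , δ , eL , s₂ , sL , r₂ with addAt-extract x b d d' eL (≡.trans (≡.sym (Sem-linear sL x)) o) r₂
...     | d'' , r₃ , r₄ =
  d'' , δ ∷ b , eL ⊎E eP ,
  SemΣ-resp s₂ (≈E-trans (addAt-cong x ≈M-refl r₃) (≡⇒≈E (addAt-addAt x [ δ ] b d''))) ,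
  b-cons sL sP ≈E-refl ≈M-refl ,
  ≈E-trans r (≈E-trans (⊎E-cong r₄ ≈E-refl) (⊎E-assoc d'' eL eP))

lsubBag-Sem⁺ : ∀ {n} (S : Sum (Term n)) x (P : Bag n) {e α} → BagSplit (λ d → SemΣ S d α) x P e →
  SemΣ (lsubBag S x P) e α
lsubBag-Sem⁺ S x [] (d , b , eP , s , b-nil p q , r) with ≈M-[]⁻ q
... | refl =
  SemΣ-resp s
    (≈E-trans (≡⇒≈E (addAt-[] x d)) (≈E-sym (≈E-trans r (≈E-trans (⊎E-cong ≈E-refl p) (⊎E-identityʳ d)))))
lsubBag-Sem⁺ S x (L ∷ P) (d , _ , _ , s , b-cons {a₁ = eL} {a₂ = eP} {β = δ} {b = b} sL sP p q , r) =
  lsubBag-Sem⁺ (lsubΣ S x L) x P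
    (d ⊎E eL , b , eP ,
     lsubΣ-Sem⁺ S x L (addAt x b d , δ , eL ,
       SemΣ-resp s (≈E-trans (addAt-cong x q ≈E-refl) (≡⇒≈E (≡.sym (addAt-addAt x [ δ ] b d)))) ,
       sL , addAt-⊎ˡ x b d eL) ,
     sP , ≈E-trans r (≈E-trans (⊎E-cong ≈E-refl p) (≈E-sym (⊎E-assoc d eL eP))))

-- Invariance under reduction

mutual
  occ-ren-∉ : ∀ {m k} (ρ : Fin m → Fin k) i → (∀ j → ρ j ≢ i) → ∀ M → occ i (ren ρ M) ≡ 0
  occ-ren-∉ ρ i ρ≢i (var j) = occVar-≢ (λ e → ρ≢i j (≡.sym e))
  occ-ren-∉ ρ i ρ≢i (lam M) = occ-ren-∉ (ext ρ) (suc i) ext≢ M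
    where
    ext≢ : ∀ j → ext ρ j ≢ suc i
    ext≢ zero ()
    ext≢ (suc j) e = ρ≢i j (suc-injective e)
  occ-ren-∉ ρ i ρ≢i (app M P) = cong₂ _+_ (occ-ren-∉ ρ i ρ≢i M) (occL-ren-∉ ρ i ρ≢i P)
  occ-ren-∉ ρ i ρ≢i (tbar V) = occL-ren-∉ ρ i ρ≢i V

  occL-ren-∉ : ∀ {m k} (ρ : Fin m → Fin k) i → (∀ j → ρ j ≢ i) → ∀ P → occL i (renL ρ P) ≡ 0
  occL-ren-∉ ρ i ρ≢i [] = refl
  occL-ren-∉ ρ i ρ≢i (L ∷ P) = cong₂ _+_ (occ-ren-∉ ρ i ρ≢i L) (occL-ren-∉ ρ i ρ≢i P)

occ-weaken : ∀ {m} (P : Bag m) → All (λ L → occ zero L ≡ 0) (renL suc P)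
occ-weaken [] = []
occ-weaken (L ∷ P) = occ-ren-∉ suc zero (λ _ ()) L ∷ occ-weaken P

++≡[]⁻ : ∀ (a : MF) {b} → a ++ b ≡ [] → a ≡ [] × b ≡ []
++≡[]⁻ [] p = refl , p

Sem-lam⁻ : ∀ {n} {M : Term (suc n)} {a b α} → Sem (lam M) a (b :: α) → Sem M (b ∷ a) α
Sem-lam⁻ (s-lam s q) with ::-injective q
... | b≈ , α≈ = Sem-resp s (≈M-sym b≈ ∷ ≈E-refl) (≈D-sym α≈)

β-reduce : ∀ {n} (M : Term (suc n)) P {e α} → Sem (app (lam M) P) e α →
  SemΣ (concatMap zeroSub (lsubBag [ M ] zero (renL suc P))) e α
β-reduce M P (s-app {a₁ = a₁} {a₂ = a₂} {b = b} sλ sP p)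
  with find (lsubBag-Sem⁺ [ M ] zero (renL suc P)
               ([] ∷ a₁ , b , [] ∷ a₂ ,
                here (Sem-resp (Sem-lam⁻ sλ) (≈M-sym (≈M-++-identityʳ b) ∷ ≈E-refl) ≈D-refl) ,
                SemBag-weaken⁺ sP , [] ∷ p))
... | t , t∈ , st = concatMap⁺ zeroSub (lose t∈ (zeroSub-Sem⁺ t st))

β-expand : ∀ {n} (M : Term (suc n)) P {e α} →
  SemΣ (concatMap zeroSub (lsubBag [ M ] zero (renL suc P))) e α → Sem (app (lam M) P) e α
β-expand M P s with find (concatMap⁻ zeroSub s)
... | t , t∈ , st with lsubBag-Sem⁻ [ M ] zero (renL suc P) (occ-weaken P) (lose t∈ (zeroSub-Sem⁻ t st))
...   | d₀ ∷ d , b , c ∷ eP , here sM , sP , r ∷ rs with SemBag-weaken⁻ P sP | ++≡[]⁻ d₀ (≈M-[]⁻ (≈M-sym r))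
...     | _ , sP' | refl , refl =
  s-app (s-lam (Sem-resp sM (≈M-++-identityʳ b ∷ ≈E-refl) ≈D-refl) ≈D-refl) sP' rs

*≈[]::* : * ≈D ([] :: *)
*≈[]::* = mk (nil-r [])

mutual
  Sem-reduce : ∀ {n} {t : Term n} {S e α} → t ⟶ S → Sem t e α → SemΣ S e α
  Sem-reduce (β {M = M} {P = P}) s = β-reduce M P s
  Sem-reduce βτ-nil (s-app (s-tbar t q) (b-nil p r) p') with ::≈*⁻ q
  ... | refl , qα =
    here (s-tbar (SemTest-resp t (≈E-sym (≈E-trans p' (≈E-trans (⊎E-cong ≈E-refl p) (⊎E-identityʳ _))))) qα)
  Sem-reduce βτ-cons (s-app (s-tbar t q) (b-cons _ _ _ r) _) with ::≈*⁻ q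
  ... | refl , _ with ≈M-length r
  ...   | ()
  Sem-reduce (lamC r) (s-lam s q) = map⁺ (Any.map (λ s' → s-lam s' q) (Sem-reduce r s))
  Sem-reduce (appL r) (s-app s sP p) = map⁺ (Any.map (λ s' → s-app s' sP p) (Sem-reduce r s))
  Sem-reduce (appR r) (s-app s sP p) = map⁺ (Any.map (λ s' → s-app s s' p) (SemBag-reduce r sP))
  Sem-reduce (tbarC r) (s-tbar t q) = map⁺ (Any.map (λ t' → s-tbar t' q) (SemTest-reduce r t))

  SemBag-reduce : ∀ {n} {P : Bag n} {S e b} → P ⟶L S → SemBag P e b → SemBagΣ S e b
  SemBag-reduce (here r) (b-cons s t p q) = map⁺ (Any.map (λ s' → b-cons s' t p q) (Sem-reduce r s))
  SemBag-reduce (there r) (b-cons s t p q) = map⁺ (Any.map (λ t' → b-cons s t' p q) (SemBag-reduce r t))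

  SemTest-reduce : ∀ {n} {V : Test n} {S e} → V ⟶T S → SemTest V e → SemTestΣ S e
  SemTest-reduce (τλ {M = M}) (t-cons (s-lam sM q) t p) with ::≈*⁻ (≈D-sym q)
  ... | refl , qα = map⁺ (Any.map (λ s' → t-cons (Sem-resp s' ≈E-refl qα) t p) (zeroSub-Sem⁺ M sM))
  SemTest-reduce (ττ {V = V} {W = W}) (t-cons (s-tbar t _) t' p) =
    here (SemTest-resp (SemTest-++⁺ V W t t') (≈E-sym p))
  SemTest-reduce (here r) (t-cons s t p) = map⁺ (Any.map (λ s' → t-cons s' t p) (Sem-reduce r s))
  SemTest-reduce (there r) (t-cons s t p) = map⁺ (Any.map (λ t' → t-cons s t' p) (SemTest-reduce r t))

mutual
  Sem-expand : ∀ {n} {t : Term n} {S e α} → t ⟶ S → SemΣ S e α → Sem t e α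
  Sem-expand (β {M = M} {P = P}) s = β-expand M P s
  Sem-expand βτ-nil (here (s-tbar t q)) =
    s-app (s-tbar t ([]::≈* q)) (b-nil ≈E-refl []) (≈E-sym (⊎E-identityʳ _))
  Sem-expand βτ-cons ()
  Sem-expand (lamC r) s with find (map⁻ s)
  ... | _ , t∈ , s-lam s' q = s-lam (Sem-expand r (lose t∈ s')) q
  Sem-expand (appL r) s with find (map⁻ s)
  ... | _ , t∈ , s-app s' sP p = s-app (Sem-expand r (lose t∈ s')) sP p
  Sem-expand (appR r) s with find (map⁻ s)
  ... | _ , Q∈ , s-app s' sQ p = s-app s' (SemBag-expand r (lose Q∈ sQ)) p
  Sem-expand (tbarC r) s with find (map⁻ s)
  ... | _ , W∈ , s-tbar t q = s-tbar (SemTest-expand r (lose W∈ t)) q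

  SemBag-expand : ∀ {n} {P : Bag n} {S e b} → P ⟶L S → SemBagΣ S e b → SemBag P e b
  SemBag-expand (here r) s with find (map⁻ s)
  ... | _ , t∈ , b-cons s' t p q = b-cons (Sem-expand r (lose t∈ s')) t p q
  SemBag-expand (there r) s with find (map⁻ s)
  ... | _ , t∈ , b-cons s' t p q = b-cons s' (SemBag-expand r (lose t∈ t)) p q

  SemTest-expand : ∀ {n} {V : Test n} {S e} → V ⟶T S → SemTestΣ S e → SemTest V e
  SemTest-expand (τλ {M = M}) s with find (map⁻ s)
  ... | _ , t∈ , t-cons s' t p = t-cons (s-lam (zeroSub-Sem⁻ M (lose t∈ s')) *≈[]::*) t p
  SemTest-expand (ττ {V = V} {W = W}) (here t) with SemTest-++⁻ V W t
  ... | _ , _ , tV , tW , r = t-cons (s-tbar tV ≈D-refl) tW r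
  SemTest-expand (here r) s with find (map⁻ s)
  ... | _ , t∈ , t-cons s' t p = t-cons (Sem-expand r (lose t∈ s')) t p
  SemTest-expand (there r) s with find (map⁻ s)
  ... | _ , t∈ , t-cons s' t p = t-cons s' (SemTest-expand r (lose t∈ t)) p

≈Σ-sym : ∀ {n} {S S' : Sum (Test n)} → S ≈Σ[ _≃L_ ] S' → S' ≈Σ[ _≃L_ ] S
≈Σ-sym (to , from) = All.map (Any.map ≃L-sym) from , All.map (Any.map ≃L-sym) to

SemTestΣ-≈Σ : ∀ {n} {S S' : Sum (Test n)} {e} → S ≈Σ[ _≃L_ ] S' → SemTestΣ S e → SemTestΣ S' e
SemTestΣ-≈Σ (to , _) s with find s
... | V , V∈ , t with find (All.lookup to V∈)
...   | _ , W∈ , V≃W = lose W∈ (SemTest-≃ t V≃W)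

SumStep-reduce : ∀ {n} {S S' : Sum (Test n)} {e} → SumStep _≃L_ _⟶T_ S S' → SemTestΣ S e → SemTestΣ S' e
SumStep-reduce (step {T = T} h r h') s with SemTestΣ-≈Σ h s
... | here t = SemTestΣ-≈Σ (≈Σ-sym h') (++⁺ˡ (SemTest-reduce r t))
... | there t = SemTestΣ-≈Σ (≈Σ-sym h') (++⁺ʳ T t)

SumStep-expand : ∀ {n} {S S' : Sum (Test n)} {e} → SumStep _≃L_ _⟶T_ S S' → SemTestΣ S' e → SemTestΣ S e
SumStep-expand (step {T = T} h r h') s with ++⁻ T (SemTestΣ-≈Σ h' s)
... | inj₁ t = SemTestΣ-≈Σ (≈Σ-sym h) (here (SemTest-expand r t))
... | inj₂ t = SemTestΣ-≈Σ (≈Σ-sym h) (there t)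

Star-reduce : ∀ {n} {S S' : Sum (Test n)} {e} → Star (SumStep _≃L_ _⟶T_) S S' → SemTestΣ S e → SemTestΣ S' e
Star-reduce ε⋆ s = s
Star-reduce (r ◅ rs) s = Star-reduce rs (SumStep-reduce r s)

Star-expand : ∀ {n} {S S' : Sum (Test n)} {e} → Star (SumStep _≃L_ _⟶T_) S S' →
  SemTestΣ S' e → SemTestΣ S e
Star-expand ε⋆ s = s
Star-expand (r ◅ rs) s = SumStep-expand r (Star-expand rs s)

↠T-expand : ∀ {n} {S S' : Sum (Test n)} {e} → S ↠T S' → SemTestΣ S' e → SemTestΣ S e
↠T-expand (_ , rs , h) s = Star-expand rs (SemTestΣ-≈Σ (≈Σ-sym h) s)

-- The terms α⁺ and the test contexts α⁻

abstractD : ∀ {r} → Vec MF r → D → D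
abstractD [] α = α
abstractD (b ∷ bs) α = abstractD bs (b :: α)

prependD : List MF → D → D
prependD [] δ = δ
prependD (a ∷ as) δ = a :: prependD as δ

prependD-* : ∀ as → prependD as * ≈D mk as
prependD-* [] = ≈D-refl
prependD-* (a ∷ as) = ::-cong ≈M-refl (prependD-* as)

abstractD-cong : ∀ {r} {bs bs' : Vec MF r} {α α'} → bs ≈E bs' → α ≈D α' → abstractD bs α ≈D abstractD bs' α'
abstractD-cong [] e = e
abstractD-cong (p ∷ q) e = abstractD-cong q (::-cong p e)

abstractD-∷ʳ : ∀ {r} (bs : Vec MF r) b α → abstractD (bs ∷ʳ b) α ≡ (b :: abstractD bs α)
abstractD-∷ʳ [] b α = refl
abstractD-∷ʳ (b' ∷ bs) b α = abstractD-∷ʳ bs b (b' :: α)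

emptyE-∷ʳ : ∀ {n} → emptyE {suc n} ≡ (emptyE {n} ∷ʳ [])
emptyE-∷ʳ {zero} = refl
emptyE-∷ʳ {suc n} = cong ([] ∷_) (emptyE-∷ʳ {n})

addAt-inject₁ : ∀ {n} (j : Fin n) x (e : Env n) y → addAt (inject₁ j) x (e ∷ʳ y) ≡ (addAt j x e ∷ʳ y)
addAt-inject₁ zero x (_ ∷ _) y = refl
addAt-inject₁ (suc j) x (z ∷ e) y = cong (z ∷_) (addAt-inject₁ j x e y)

addAt-fromℕ : ∀ {n} x (e : Env n) y → addAt (fromℕ n) x (e ∷ʳ y) ≡ (e ∷ʳ (x ++ y))
addAt-fromℕ x [] y = refl
addAt-fromℕ x (z ∷ e) y = cong (z ∷_) (addAt-fromℕ x e y)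

pushE-inject₁ : ∀ {m n} (f : Fin m → Fin n) (e : Env m) → pushE (λ i → inject₁ (f i)) e ≡ (pushE f e ∷ʳ [])
pushE-inject₁ f [] = emptyE-∷ʳ
pushE-inject₁ f (x ∷ e) =
  ≡.trans (cong (addAt (inject₁ (f zero)) x) (pushE-inject₁ (λ i → f (suc i)) e))
    (addAt-inject₁ (f zero) x _ [])

pushE-opposite : ∀ {n} a (e : Env n) → pushE opposite (a ∷ e) ≡ (pushE opposite e ∷ʳ (a ++ []))
pushE-opposite {n} a e = ≡.trans (cong (addAt (fromℕ n) a) (pushE-inject₁ opposite e)) (addAt-fromℕ a _ [])

-- the variable bound by the i-th outermost λ of lams is de Bruijn index opposite i
abstractD-opposite : ∀ as → abstractD (pushE opposite (fromList as)) * ≈D mk as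
abstractD-opposite [] = ≈D-refl
abstractD-opposite (a ∷ as)
  rewrite pushE-opposite a (fromList as) | abstractD-∷ʳ (pushE opposite (fromList as)) (a ++ []) * =
  ::-cong (≈M-++-identityʳ a) (abstractD-opposite as)

Sem-lams⁻ : ∀ r (t : Term r) {δ} → Sem (lams r t) [] δ → Σ (Vec MF r) λ bs → Σ D λ α →
  Sem t bs α × δ ≈D abstractD bs α
Sem-lams⁻ zero t {δ} s = [] , δ , s , ≈D-refl
Sem-lams⁻ (suc r) t s with Sem-lams⁻ r (lam t) s
... | bs , _ , s-lam {b = b} {α = α} s' q , e =
  b ∷ bs , α , s' , ≈D-trans e (abstractD-cong {bs = bs} ≈E-refl q)

Sem-lams⁺ : ∀ r (t : Term r) bs α → Sem t bs α → Sem (lams r t) [] (abstractD bs α)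
Sem-lams⁺ zero t [] α s = s
Sem-lams⁺ (suc r) t (b ∷ bs) α s = Sem-lams⁺ r (lam t) bs (b :: α) (s-lam s ≈D-refl)

mutual
  Sem-plus⁻ : ∀ γ {δ} → Sem (plusN γ) [] δ → δ ≈D γ
  Sem-plus⁻ (mk as) s with Sem-lams⁻ (length as) (tbar (body as opposite)) s
  ... | bs , α , s-tbar t q , e =
    ≈D-trans e (≈D-trans (abstractD-cong (SemTest-body⁻ as opposite t) q) (abstractD-opposite as))

  SemTest-body⁻ : ∀ {m} (as : List MF) (f : Fin (length as) → Fin m) {e} →
    SemTest (body as f) e → e ≈E pushE f (fromList as)
  SemTest-body⁻ [] f (t-nil p) = p
  SemTest-body⁻ (a ∷ as) f t with SemTest-++⁻ (bagTests a (var (f zero))) (body as (λ i → f (suc i))) t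
  ... | _ , _ , t₁ , t₂ , r =
    ≈E-trans r (≈E-trans (⊎E-cong (SemTest-bagTests⁻ a (f zero) t₁) (SemTest-body⁻ as (λ i → f (suc i)) t₂))
      (≈E-trans (≈E-sym (addAt-⊎ˡ (f zero) a emptyE _)) (addAt-cong (f zero) ≈M-refl (⊎E-identityˡ _))))

  SemTest-bagTests⁻ : ∀ {m} (a : MF) (j : Fin m) {e} →
    SemTest (bagTests a (var j)) e → e ≈E addAt j a emptyE
  SemTest-bagTests⁻ [] j (t-nil p) = ≈E-trans p (≡⇒≈E (≡.sym (addAt-[] j emptyE)))
  SemTest-bagTests⁻ (γ ∷ a) j t with SemTest-++⁻ (minusN γ (var j)) (bagTests a (var j)) t
  ... | _ , _ , t₁ , t₂ , r with Sem-minus⁻ γ (var j) t₁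
  ...   | s-var p =
    ≈E-trans r (≈E-trans (⊎E-cong (≈E-trans p (≡⇒≈E (≡.sym (addAt-singleton j γ))))
                                  (SemTest-bagTests⁻ a j t₂))
      (≈E-trans (≈E-sym (addAt-⊎ j [ γ ] a emptyE emptyE)) (addAt-cong j ≈M-refl (⊎E-identityˡ emptyE))))

  Sem-minus⁻ : ∀ {m} γ (t : Term m) {e} → SemTest (minusN γ t) e → Sem t e γ
  Sem-minus⁻ (mk as) t (t-cons s (t-nil p) q) =
    Sem-resp (Sem-apps⁻ as t s) (≈E-sym (≈E-trans q (≈E-trans (⊎E-cong ≈E-refl p) (⊎E-identityʳ _))))
      (prependD-* as)

  Sem-apps⁻ : ∀ {m} (as : List MF) (t : Term m) {e δ} → Sem (apps t as) e δ → Sem t e (prependD as δ)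
  Sem-apps⁻ [] t s = s
  Sem-apps⁻ (a ∷ as) t s with Sem-apps⁻ as (app t (bagPlus a)) s
  ... | s-app s₁ sB p with SemBag-bagPlus⁻ a sB
  ...   | pe , pc =
    Sem-resp s₁ (≈E-sym (≈E-trans p (≈E-trans (⊎E-cong ≈E-refl pe) (⊎E-identityʳ _)))) (::-cong pc ≈D-refl)

  SemBag-bagPlus⁻ : ∀ {m} (a : MF) {e : Env m} {c} → SemBag (bagPlus a) e c → e ≈E emptyE × c ≈M a
  SemBag-bagPlus⁻ [] (b-nil p q) = p , q
  SemBag-bagPlus⁻ (γ ∷ a) (b-cons s t p q) with Sem-ren⁻ (λ ()) (plusN γ) s | SemBag-bagPlus⁻ a t
  ... | [] , s' , r | pe , pc =
    ≈E-trans p (≈E-trans (⊎E-cong (≈E-trans r (≡⇒≈E (pushE-empty {zero} (λ ())))) pe) (⊎E-identityˡ emptyE)) ,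
    trans q (Sem-plus⁻ γ s' ∷ pc)

mutual
  Sem-plus⁺ : ∀ γ {δ} → δ ≈D γ → Sem (plusN γ) [] δ
  Sem-plus⁺ (mk as) e =
    Sem-resp (Sem-lams⁺ (length as) (tbar (body as opposite)) (pushE opposite (fromList as)) *
               (s-tbar (SemTest-body⁺ as opposite ≈E-refl) ≈D-refl))
      [] (≈D-trans (abstractD-opposite as) (≈D-sym e))

  SemTest-body⁺ : ∀ {m} (as : List MF) (f : Fin (length as) → Fin m) {e} →
    e ≈E pushE f (fromList as) → SemTest (body as f) e
  SemTest-body⁺ [] f p = t-nil p
  SemTest-body⁺ (a ∷ as) f p =
    SemTest-resp (SemTest-++⁺ (bagTests a (var (f zero))) (body as (λ i → f (suc i)))
                   (SemTest-bagTests⁺ a (f zero) ≈E-refl) (SemTest-body⁺ as (λ i → f (suc i)) ≈E-refl))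
      (≈E-sym (≈E-trans p (≈E-trans (addAt-cong (f zero) ≈M-refl (≈E-sym (⊎E-identityˡ _)))
                                      (addAt-⊎ˡ (f zero) a emptyE _))))

  SemTest-bagTests⁺ : ∀ {m} (a : MF) (j : Fin m) {e} →
    e ≈E addAt j a emptyE → SemTest (bagTests a (var j)) e
  SemTest-bagTests⁺ [] j p = t-nil (≈E-trans p (≡⇒≈E (addAt-[] j emptyE)))
  SemTest-bagTests⁺ (γ ∷ a) j p =
    SemTest-resp (SemTest-++⁺ (minusN γ (var j)) (bagTests a (var j))
                   (Sem-minus⁺ γ (var j) (s-var ≈E-refl)) (SemTest-bagTests⁺ a j ≈E-refl))
      (≈E-sym (≈E-trans p (≈E-trans (≈E-sym (addAt-cong j ≈M-refl (⊎E-identityˡ emptyE)))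
        (≈E-trans (addAt-⊎ j [ γ ] a emptyE emptyE) (⊎E-cong (≡⇒≈E (addAt-singleton j γ)) ≈E-refl)))))

  Sem-minus⁺ : ∀ {m} γ (t : Term m) {e} → Sem t e γ → SemTest (minusN γ t) e
  Sem-minus⁺ (mk as) t {e} s =
    t-cons (Sem-apps⁺ as t (Sem-resp s ≈E-refl (≈D-sym (prependD-* as)))) (t-nil ≈E-refl)
      (≈E-sym (⊎E-identityʳ e))

  Sem-apps⁺ : ∀ {m} (as : List MF) (t : Term m) {e δ} → Sem t e (prependD as δ) → Sem (apps t as) e δ
  Sem-apps⁺ [] t s = s
  Sem-apps⁺ (a ∷ as) t {e} s =
    Sem-apps⁺ as (app t (bagPlus a)) (s-app s (SemBag-bagPlus⁺ a) (≈E-sym (⊎E-identityʳ e)))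

  SemBag-bagPlus⁺ : ∀ {m} (a : MF) → SemBag {m} (bagPlus a) emptyE a
  SemBag-bagPlus⁺ [] = b-nil ≈E-refl []
  SemBag-bagPlus⁺ (γ ∷ a) =
    b-cons (Sem-resp (Sem-ren⁺ (λ ()) (Sem-plus⁺ γ ≈D-refl)) (≡⇒≈E (pushE-empty {zero} (λ ()))) ≈D-refl)
      (SemBag-bagPlus⁺ a) (≈E-sym (⊎E-identityˡ emptyE)) ≈M-refl

SemTest-⁻[] : ∀ {m} α (t : Term m) {e} → SemTest (α ⁻[ t ]) e ⇔ Sem t e α
SemTest-⁻[] α t = mk⇔ (λ s → Sem-resp (Sem-minus⁻ (norm α) t s) ≈E-refl (norm≈ α))
                      (λ s → Sem-minus⁺ (norm α) t (Sem-resp s ≈E-refl (≈D-sym (norm≈ α))))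

occ-bagPlus : ∀ {m} (x : Fin m) a → All (λ L → occ x L ≡ 0) (bagPlus {m} a)
occ-bagPlus x [] = []
occ-bagPlus x (γ ∷ a) = occ-ren-∉ (λ ()) x (λ ()) (plusN γ) ∷ occ-bagPlus x a

lsubBag-⁺B : ∀ {n} (S : Sum (Term n)) x a {e α} → SemΣ (lsubBag S x (a ⁺B)) e α ⇔ SemΣ S (addAt x a e) α
lsubBag-⁺B S x a {e} =
  mk⇔ to (λ s → lsubBag-Sem⁺ S x (a ⁺B) (e , a , emptyE , s , bag-a , ≈E-sym (⊎E-identityʳ e)))
  where
  bag-a : SemBag (a ⁺B) emptyE a
  bag-a = SemBag-resp (SemBag-bagPlus⁺ (normM a)) ≈E-refl (normM≈ a)
  to : SemΣ (lsubBag S x (a ⁺B)) e _ → SemΣ S (addAt x a e) _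
  to s with lsubBag-Sem⁻ S x (a ⁺B) (occ-bagPlus x (normM a)) s
  ... | d , b , eP , s₁ , sP , r with SemBag-bagPlus⁻ (normM a) sP
  ...   | eP≈∅ , b≈a =
    SemΣ-resp s₁
      (addAt-cong x (trans b≈a (normM≈ a))
      (≈E-sym (≈E-trans r (≈E-trans (⊎E-cong ≈E-refl eP≈∅) (⊎E-identityʳ d)))))

substFold : ∀ {n} → List (Fin n × MF) → Sum (Term n) → Sum (Term n)
substFold L S = foldl (λ S p → lsubBag S (proj₁ p) (proj₂ p ⁺B)) S L

addAll : ∀ {n} → List (Fin n × MF) → Env n → Env n
addAll [] e = e
addAll ((x , a) ∷ L) e = addAt x a (addAll L e)

substFold-Sem : ∀ {n} (L : List (Fin n × MF)) (S : Sum (Term n)) {e α} →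
  SemΣ (substFold L S) e α ⇔ SemΣ S (addAll L e) α
substFold-Sem [] S = ⇔-refl
substFold-Sem ((x , a) ∷ L) S = ⇔-trans (substFold-Sem L (lsubBag S x (a ⁺B))) (lsubBag-⁺B S x a)

addAll-tabulate : ∀ {m n} (f : Fin m → Fin n) (v : Env m) e →
  addAll (toList (zip (tabulate f) v)) e ≈E (pushE f v ⊎E e)
addAll-tabulate f [] e = ≈E-sym (⊎E-identityˡ e)
addAll-tabulate f (x ∷ v) e =
  ≈E-trans (addAt-cong (f zero) ≈M-refl (addAll-tabulate (λ i → f (suc i)) v e)) (addAt-⊎ˡ (f zero) x _ e)

addAll-allFin : ∀ {n} (a : Env n) → addAll (toList (zip (allFin n) a)) emptyE ≈E a
addAll-allFin a = ≈E-trans (addAll-tabulate (λ i → i) a emptyE) (≈E-trans (⊎E-identityʳ _) (pushE-id a))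

SemTestΣ-⁻[]Σ : ∀ {n} α (S : Sum (Term n)) {e} → SemTestΣ (α ⁻[ S ]Σ) e ⇔ SemΣ S e α
SemTestΣ-⁻[]Σ α S = mk⇔ (λ s → Any.map (λ {t} → Equivalence.to (SemTest-⁻[] α t)) (map⁻ s))
                        (λ s → map⁺ (Any.map (λ {t} → Equivalence.from (SemTest-⁻[] α t)) s))

substAll-Sem : ∀ {n} (M : Term n) (a : Env n) α → SemTestΣ (α ⁻[ substAll M a ]Σ) emptyE ⇔ Sem M a α
substAll-Sem {n} M a α =
  ⇔-trans (SemTestΣ-⁻[]Σ α (substAll M a)) (⇔-trans (substFold-Sem (toList (zip (allFin n) a)) [ M ])
    (mk⇔ (λ { (here s) → Sem-resp s (addAll-allFin a) ≈D-refl })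
         (λ s → here (Sem-resp s (≈E-sym (addAll-allFin a)) ≈D-refl))))

mutual
  size : ∀ {n} → Term n → ℕ
  size (var _) = 1
  size (lam M) = suc (size M)
  size (app M P) = suc (size M + sizeL P)
  size (tbar V) = suc (sizeL V)

  sizeL : ∀ {n} → List (Term n) → ℕ
  sizeL [] = 0
  sizeL (L ∷ P) = size L + sizeL P

mutual
  size-ren : ∀ {m k} (ρ : Fin m → Fin k) M → size (ren ρ M) ≡ size M
  size-ren ρ (var _) = refl
  size-ren ρ (lam M) = cong suc (size-ren (ext ρ) M)
  size-ren ρ (app M P) = cong suc (cong₂ _+_ (size-ren ρ M) (sizeL-ren ρ P))
  size-ren ρ (tbar V) = cong suc (sizeL-ren ρ V)

  sizeL-ren : ∀ {m k} (ρ : Fin m → Fin k) P → sizeL (renL ρ P) ≡ sizeL P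
  sizeL-ren ρ [] = refl
  sizeL-ren ρ (L ∷ P) = cong₂ _+_ (size-ren ρ L) (sizeL-ren ρ P)

ext-injective : ∀ {m k} {ρ : Fin m → Fin k} → Injective _≡_ _≡_ ρ → Injective _≡_ _≡_ (ext ρ)
ext-injective inj {zero} {zero} _ = refl
ext-injective inj {suc _} {suc _} e = cong suc (inj (suc-injective e))

occVar-ren : ∀ {m k} (ρ : Fin m → Fin k) → Injective _≡_ _≡_ ρ → ∀ j i → occVar (ρ j) (ρ i) ≡ occVar j i
occVar-ren ρ inj j i with j ≟ i
... | yes refl = ≡.trans (occVar-refl (ρ j)) (≡.sym (occVar-refl j))
... | no j≢i = ≡.trans (occVar-≢ (λ e → j≢i (inj e))) (≡.sym (occVar-≢ j≢i))

mutual
  occ-ren : ∀ {m k} (ρ : Fin m → Fin k) → Injective _≡_ _≡_ ρ → ∀ j M → occ (ρ j) (ren ρ M) ≡ occ j M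
  occ-ren ρ inj j (var i) = occVar-ren ρ inj j i
  occ-ren ρ inj j (lam M) = occ-ren (ext ρ) (ext-injective inj) (suc j) M
  occ-ren ρ inj j (app M P) = cong₂ _+_ (occ-ren ρ inj j M) (occL-ren ρ inj j P)
  occ-ren ρ inj j (tbar V) = occL-ren ρ inj j V

  occL-ren : ∀ {m k} (ρ : Fin m → Fin k) → Injective _≡_ _≡_ ρ → ∀ j P → occL (ρ j) (renL ρ P) ≡ occL j P
  occL-ren ρ inj j [] = refl
  occL-ren ρ inj j (L ∷ P) = cong₂ _+_ (occ-ren ρ inj j L) (occL-ren ρ inj j P)

+-balanceʳ : ∀ a b {c d} p → a + c ≡ b + d → (a + p) + c ≡ (b + p) + d
+-balanceʳ a b {c} {d} p e = ≡.trans (xy∙z≈xz∙y a p c) (≡.trans (cong (_+ p) e) (≡.sym (xy∙z≈xz∙y b p d)))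

+-balanceˡ : ∀ a b {c d} m → a + c ≡ b + d → (m + a) + c ≡ (m + b) + d
+-balanceˡ a b {c} {d} m e = ≡.trans (+-assoc m a c) (≡.trans (cong (m +_) e) (≡.sym (+-assoc m b d)))

+-chain : ∀ u s₁ s₀ {w q v l} → u + w ≡ s₁ + q → s₁ + v ≡ s₀ + l → u + (v + w) ≡ s₀ + (l + q)
+-chain u s₁ s₀ {w} {q} {v} {l} e₁ e₂ =
  ≡.trans (x∙yz≈xz∙y u v w) (≡.trans (cong (_+ v) e₁)
    (≡.trans (xy∙z≈xz∙y s₁ q v) (≡.trans (cong (_+ q) e₂) (+-assoc s₀ l q))))

-- one linear substitution replaces one occurrence of x, of size 1, by N
mutual
  lsub-size : ∀ {n} (M : Term n) x N {s} → s ∈ lsub M x N → size s + 1 ≡ size M + size N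
  lsub-size (var y) x N s∈ with x ≟ y
  lsub-size (var y) x N (here refl) | yes refl = +-comm (size N) 1
  lsub-size (lam M) x N s∈ with ∈-map⁻ lam s∈
  ... | s' , s'∈ , refl =
    cong suc (≡.trans (lsub-size M (suc x) (ren suc N) s'∈) (cong (size M +_) (size-ren suc N)))
  lsub-size (app M P) x N s∈ with ∈-++⁻ (map (λ M' → app M' P) (lsub M x N)) s∈
  ... | inj₁ s∈₁ with ∈-map⁻ (λ M' → app M' P) s∈₁
  ...   | s' , s'∈ , refl = cong suc (+-balanceʳ (size s') (size M) (sizeL P) (lsub-size M x N s'∈))
  lsub-size (app M P) x N s∈ | inj₂ s∈₂ with ∈-map⁻ (app M) s∈₂
  ...   | Q , Q∈ , refl = cong suc (+-balanceˡ (sizeL Q) (sizeL P) (size M) (lsubL-size P x N Q∈))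
  lsub-size (tbar V) x N s∈ with ∈-map⁻ tbar s∈
  ... | W , W∈ , refl = cong suc (lsubL-size V x N W∈)

  lsubL-size : ∀ {n} (P : List (Term n)) x N {Q} → Q ∈ lsubL P x N → sizeL Q + 1 ≡ sizeL P + size N
  lsubL-size (L ∷ P) x N Q∈ with ∈-++⁻ (map (_∷ P) (lsub L x N)) Q∈
  ... | inj₁ Q∈₁ with ∈-map⁻ (_∷ P) Q∈₁
  ...   | s' , s'∈ , refl = +-balanceʳ (size s') (size L) (sizeL P) (lsub-size L x N s'∈)
  lsubL-size (L ∷ P) x N Q∈ | inj₂ Q∈₂ with ∈-map⁻ (L ∷_) Q∈₂
  ...   | Q' , Q'∈ , refl = +-balanceˡ (sizeL Q') (sizeL P) (size L) (lsubL-size P x N Q'∈)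

mutual
  lsub-occ : ∀ {n} (M : Term n) x N {s} → s ∈ lsub M x N → ∀ j → occ j s + occVar j x ≡ occ j M + occ j N
  lsub-occ (var y) x N s∈ j with x ≟ y
  lsub-occ (var y) x N (here refl) j | yes refl = +-comm (occ j N) (occVar j x)
  lsub-occ (lam M) x N s∈ j with ∈-map⁻ lam s∈
  ... | s' , s'∈ , refl =
    ≡.trans (lsub-occ M (suc x) (ren suc N) s'∈ (suc j))
      (cong (occ (suc j) M +_) (occ-ren suc suc-injective j N))
  lsub-occ (app M P) x N s∈ j with ∈-++⁻ (map (λ M' → app M' P) (lsub M x N)) s∈
  ... | inj₁ s∈₁ with ∈-map⁻ (λ M' → app M' P) s∈₁
  ...   | s' , s'∈ , refl = +-balanceʳ (occ j s') (occ j M) (occL j P) (lsub-occ M x N s'∈ j)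
  lsub-occ (app M P) x N s∈ j | inj₂ s∈₂ with ∈-map⁻ (app M) s∈₂
  ...   | Q , Q∈ , refl = +-balanceˡ (occL j Q) (occL j P) (occ j M) (lsubL-occ P x N Q∈ j)
  lsub-occ (tbar V) x N s∈ j with ∈-map⁻ tbar s∈
  ... | W , W∈ , refl = lsubL-occ V x N W∈ j

  lsubL-occ : ∀ {n} (P : List (Term n)) x N {Q} → Q ∈ lsubL P x N → ∀ j →
    occL j Q + occVar j x ≡ occL j P + occ j N
  lsubL-occ (L ∷ P) x N Q∈ j with ∈-++⁻ (map (_∷ P) (lsub L x N)) Q∈
  ... | inj₁ Q∈₁ with ∈-map⁻ (_∷ P) Q∈₁
  ...   | s' , s'∈ , refl = +-balanceʳ (occ j s') (occ j L) (occL j P) (lsub-occ L x N s'∈ j)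
  lsubL-occ (L ∷ P) x N Q∈ j | inj₂ Q∈₂ with ∈-map⁻ (L ∷_) Q∈₂
  ...   | Q' , Q'∈ , refl = +-balanceˡ (occL j Q') (occL j P) (occ j L) (lsubL-occ P x N Q'∈ j)

lsubBag-origin : ∀ {n} (S : Sum (Term n)) x (P : Bag n) {u} → u ∈ lsubBag S x P →
  Σ (Term n) λ s → s ∈ S × (size u + length P ≡ size s + sizeL P)
                         × (∀ j → occ j u + length P Nat.* occVar j x ≡ occ j s + occL j P)
lsubBag-origin S x [] {u} u∈ = u , u∈ , refl , λ _ → refl
lsubBag-origin S x (L ∷ P) {u} u∈ with lsubBag-origin (lsubΣ S x L) x P u∈
... | s₁ , s₁∈ , size₁ , occ₁ with find (∈-concatMap⁻ (λ A → lsub A x L) {xs = S} s₁∈)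
...   | s , s∈ , s₁∈' =
  s , s∈ , +-chain (size u) (size s₁) (size s) size₁ (lsub-size s x L s₁∈') ,
  λ j → +-chain (occ j u) (occ j s₁) (occ j s) (occ₁ j) (lsub-occ s x L s₁∈' j)

-- Reduction decreases size and does not create free occurrences

infix 4 _≺_ _≺L_

record _≺_ {n} (s t : Term n) : Set where
  constructor _,_
  field
    size< : size s < size t
    occ≤ : ∀ j → occ j s ≤ occ j t

record _≺L_ {n} (P Q : List (Term n)) : Set where
  constructor _,_
  field
    sizeL< : sizeL P < sizeL Q
    occL≤ : ∀ j → occL j P ≤ occL j Q

zeroSub-ren : ∀ {n} (u : Term (suc n)) {s} → s ∈ zeroSub u → u ≡ ren suc s
zeroSub-ren u s∈ with str zero u in eq
zeroSub-ren u (here refl) | just _ = str-ren zero u eq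

β-≺ : ∀ {n} (M : Term (suc n)) P {s} → s ∈ concatMap zeroSub (lsubBag [ M ] zero (renL suc P)) →
  s ≺ app (lam M) P
β-≺ M P {s} s∈ with find (∈-concatMap⁻ zeroSub {xs = lsubBag [ M ] zero (renL suc P)} s∈)
... | u , u∈ , s∈' with zeroSub-ren u s∈'
...   | refl with lsubBag-origin [ M ] zero (renL suc P) u∈
...     | _ , here refl , size≡ , occ≡ = s≤s size≤ , λ j → ≤-reflexive (occ≡′ j)
  where
  P' = renL suc P
  size≤ : size s ≤ suc (size M + sizeL P)
  size≤ = begin
    size s                          ≡⟨ size-ren suc s ⟨
    size u                          ≤⟨ m≤m+n _ (length P') ⟩
    size u + length P'              ≡⟨ size≡ ⟩
    size M + sizeL P'               ≡⟨ cong (size M +_) (sizeL-ren suc P) ⟩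
    size M + sizeL P                ≤⟨ n≤1+n _ ⟩
    suc (size M + sizeL P)          ∎
    where open ≤-Reasoning
  occ≡′ : ∀ j → occ j s ≡ occ (suc j) M + occL j P
  occ≡′ j = begin
    occ j s                                    ≡⟨ occ-ren suc suc-injective j s ⟨
    occ (suc j) u                              ≡⟨ +-identityʳ _ ⟨
    occ (suc j) u + 0                          ≡⟨ cong (occ (suc j) u +_) (*-zeroʳ (length P')) ⟨
    occ (suc j) u + length P' Nat.* 0          ≡⟨ occ≡ (suc j) ⟩
    occ (suc j) M + occL (suc j) P'            ≡⟨ cong (occ (suc j) M +_) (occL-ren suc suc-injective j P) ⟩
    occ (suc j) M + occL j P                   ∎
    where open ≡-Reasoning

sizeL-++ : ∀ {n} (V W : List (Term n)) → sizeL (V ++ W) ≡ sizeL V + sizeL W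
sizeL-++ [] W = refl
sizeL-++ (L ∷ V) W = ≡.trans (cong (size L +_) (sizeL-++ V W))
  (≡.sym (+-assoc (size L) (sizeL V) (sizeL W)))

occL-++ : ∀ {n} j (V W : List (Term n)) → occL j (V ++ W) ≡ occL j V + occL j W
occL-++ j [] W = refl
occL-++ j (L ∷ V) W =
  ≡.trans (cong (occ j L +_) (occL-++ j V W)) (≡.sym (+-assoc (occ j L) (occL j V) (occL j W)))

∷-≺L : ∀ {n} {L L' : Term n} P → L' ≺ L → (L' ∷ P) ≺L (L ∷ P)
∷-≺L P (lt , le) = +-monoˡ-< (sizeL P) lt , λ j → +-mono-≤ (le j) ≤-refl

≺L-∷ : ∀ {n} L {P P' : List (Term n)} → P' ≺L P → (L ∷ P') ≺L (L ∷ P)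
≺L-∷ L (lt , le) = +-monoʳ-< (size L) lt , λ j → +-mono-≤ (≤-refl {occ j L}) (le j)

mutual
  ⟶-≺ : ∀ {n} {t : Term n} {S} → t ⟶ S → ∀ {s} → s ∈ S → s ≺ t
  ⟶-≺ (β {M = M} {P = P}) s∈ = β-≺ M P s∈
  ⟶-≺ (βτ-nil {V = V}) (here refl) = s≤s (s≤s (m≤m+n (sizeL V) 0)) , λ j → m≤m+n (occL j V) 0
  ⟶-≺ (lamC r) s∈ with ∈-map⁻ lam s∈
  ... | _ , s'∈ , refl with ⟶-≺ r s'∈
  ...   | lt , le = s≤s lt , λ j → le (suc j)
  ⟶-≺ (appL {P = P} r) s∈ with ∈-map⁻ (λ M' → app M' P) s∈
  ... | _ , s'∈ , refl with ∷-≺L P (⟶-≺ r s'∈)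
  ...   | lt , le = s≤s lt , le
  ⟶-≺ (appR {M = M} r) s∈ with ∈-map⁻ (app M) s∈
  ... | _ , Q∈ , refl with ≺L-∷ M (⟶L-≺L r Q∈)
  ...   | lt , le = s≤s lt , le
  ⟶-≺ (tbarC r) s∈ with ∈-map⁻ tbar s∈
  ... | _ , W∈ , refl with ⟶T-≺L r W∈
  ...   | lt , le = s≤s lt , le

  ⟶L-≺L : ∀ {n} {P : List (Term n)} {S} → P ⟶L S → ∀ {Q} → Q ∈ S → Q ≺L P
  ⟶L-≺L (here {P = P} r) Q∈ with ∈-map⁻ (_∷ P) Q∈
  ... | _ , s'∈ , refl = ∷-≺L P (⟶-≺ r s'∈)
  ⟶L-≺L (there {L = L} r) Q∈ with ∈-map⁻ (L ∷_) Q∈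
  ... | _ , Q'∈ , refl = ≺L-∷ L (⟶L-≺L r Q'∈)

  ⟶T-≺L : ∀ {n} {V : List (Term n)} {S} → V ⟶T S → ∀ {W} → W ∈ S → W ≺L V
  ⟶T-≺L (τλ {M = M} {V = V}) W∈ with ∈-map⁻ (_∷ V) W∈
  ... | s , s∈ , refl with zeroSub-ren M s∈
  ...   | refl = ∷-≺L V (s≤s (≤-reflexive (≡.sym (size-ren suc s))) ,
                          λ j → ≤-reflexive (≡.sym (occ-ren suc suc-injective j s)))
  ⟶T-≺L (ττ {V = V} {W = W}) (here refl) =
    ≤-reflexive (cong suc (sizeL-++ V W)) , λ j → ≤-reflexive (occL-++ j V W)
  ⟶T-≺L (here {V = P} r) Q∈ with ∈-map⁻ (_∷ P) Q∈
  ... | _ , s'∈ , refl = ∷-≺L P (⟶-≺ r s'∈)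
  ⟶T-≺L (there {L = L} r) Q∈ with ∈-map⁻ (L ∷_) Q∈
  ... | _ , Q'∈ , refl = ≺L-∷ L (⟶T-≺L r Q'∈)

-- Closed tests reduce to sums of ε

Closed : ∀ {n} → Term n → Set
Closed t = ∀ j → occ j t ≡ 0

ClosedL : ∀ {n} → List (Term n) → Set
ClosedL P = ∀ j → occL j P ≡ 0

var-not-closed : ∀ {n} (i : Fin n) k → occ i (var i) + k ≢ 0
var-not-closed i k o with ≡.trans (≡.sym (occVar-refl i)) (m+n≡0⇒m≡0 (occVar i i) o)
... | ()

app-progress : ∀ {n} (M : Term n) P → Closed (app M P) → Σ (Sum (Term n)) (app M P ⟶_)
app-progress (var i) P c = ⊥-elim (var-not-closed i _ (c i))
app-progress (lam M) P c = _ , β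
app-progress (tbar V) [] c = _ , βτ-nil
app-progress (tbar V) (L ∷ P) c = _ , βτ-cons
app-progress (app M P') P c with app-progress M P' (λ j → m+n≡0⇒m≡0 (occ j (app M P')) (c j))
... | _ , r = _ , appL r

test-progress : ∀ {n} (L : Term n) V → ClosedL (L ∷ V) → Σ (Sum (Test n)) ((L ∷ V) ⟶T_)
test-progress (var i) V c = ⊥-elim (var-not-closed i _ (c i))
test-progress (lam M) V c = _ , τλ
test-progress (tbar V') V c = _ , ττ
test-progress (app M P) V c with app-progress M P (λ j → m+n≡0⇒m≡0 (occ j (app M P)) (c j))
... | _ , r = _ , here r

-- SumStep with the redex located syntactically rather than up to ≈Σ, so that it is compatible with _++_
data _↦_ {n} (A B : Sum (Test n)) : Set where
  step : ∀ pre V post {T} → V ⟶T T → A ≡ pre ++ V ∷ post → B ≡ pre ++ T ++ post → A ↦ B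

↦-++ʳ : ∀ {n} {A B : Sum (Test n)} C → A ↦ B → (A ++ C) ↦ (B ++ C)
↦-++ʳ C (step pre V post {T} r refl refl) =
  step pre V (post ++ C) r (++-assoc pre (V ∷ post) C)
    (≡.trans (++-assoc pre (T ++ post) C) (cong (pre ++_) (++-assoc T post C)))

↦-++ˡ : ∀ {n} {A B : Sum (Test n)} C → A ↦ B → (C ++ A) ↦ (C ++ B)
↦-++ˡ C (step pre V post {T} r refl refl) =
  step (C ++ pre) V post r (≡.sym (++-assoc C pre (V ∷ post))) (≡.sym (++-assoc C pre (T ++ post)))

Normalises : ∀ {n} → Sum (Test n) → Set
Normalises {n} S = Σ (Sum (Test n)) λ R → Star _↦_ S R × All (_≡ ε) R

Normalises-++ : ∀ {n} {A B : Sum (Test n)} → Normalises A → Normalises B → Normalises (A ++ B)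
Normalises-++ {B = B} (R₁ , rs₁ , u₁) (R₂ , rs₂ , u₂) =
  R₁ ++ R₂ , gmap (_++ B) (↦-++ʳ B) rs₁ ◅◅ gmap (R₁ ++_) (↦-++ˡ R₁) rs₂ , AllProps.++⁺ u₁ u₂

≺L-bounded : ∀ {n k} {V W : Test n} → sizeL V < suc k → ClosedL V → W ≺L V → sizeL W < k × ClosedL W
≺L-bounded (s≤s lt) c (size< , occ≤) =
  ≤-trans size< lt , λ j → n≤0⇒n≡0 (≤-trans (occ≤ j) (≤-reflexive (c j)))

mutual
  test-normalises : ∀ {n} k (V : Test n) → sizeL V < k → ClosedL V → Normalises [ V ]
  test-normalises (suc k) [] _ _ = [ ε ] , ε⋆ , refl ∷ []
  test-normalises (suc k) (L ∷ V) lt c with test-progress L V c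
  ... | T , r with sum-normalises k T (All.tabulate λ W∈ → ≺L-bounded lt c (⟶T-≺L r W∈))
  ...   | R , rs , units = R , step [] (L ∷ V) [] r refl (≡.sym (++-identityʳ T)) ◅ rs , units

  sum-normalises : ∀ {n} k (T : Sum (Test n)) → All (λ W → sizeL W < k × ClosedL W) T → Normalises T
  sum-normalises k [] [] = [] , ε⋆ , []
  sum-normalises k (W ∷ T) ((lt , c) ∷ hs) =
    Normalises-++ (test-normalises k W lt c) (sum-normalises k T hs)

closed-normalises : ∀ {n} (T : Sum (Test n)) → All ClosedL T → Normalises T
closed-normalises [] [] = [] , ε⋆ , []
closed-normalises (W ∷ T) (c ∷ cs) =
  Normalises-++ (test-normalises (suc (sizeL W)) W ≤-refl c) (closed-normalises T cs)

↭⇒≈Σ : ∀ {n} {A B : Sum (Test n)} → A ↭ₚ B → A ≈Σ[ _≃L_ ] B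
↭⇒≈Σ p = All.tabulate (λ V∈ → Any.map (λ { refl → ≃L-refl }) (∈-resp-↭ₚ p V∈)) ,
         All.tabulate (λ V∈ → Any.map (λ { refl → ≃L-refl }) (∈-resp-↭ₚ (↭ₚ-sym p) V∈))

↦⇒SumStep : ∀ {n} {A B : Sum (Test n)} → A ↦ B → SumStep _≃L_ _⟶T_ A B
↦⇒SumStep (step pre V post {T} r refl refl) = step (↭⇒≈Σ (shiftₚ V pre post)) r (↭⇒≈Σ (shiftsₚ pre T))

-- The substituted tests are closed

length-lookup-addAt : ∀ {n} (x : Fin n) a e j →
  length (lookup (addAt x a e) j) ≡ length a Nat.* occVar j x + length (lookup e j)
length-lookup-addAt zero a (y ∷ e) zero =
  ≡.trans (length-++ a) (cong (_+ length y) (≡.sym (*-identityʳ (length a))))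
length-lookup-addAt zero a (y ∷ e) (suc j) = cong (_+ length (lookup e j)) (≡.sym (*-zeroʳ (length a)))
length-lookup-addAt (suc x) a (y ∷ e) zero = cong (_+ length y) (≡.sym (*-zeroʳ (length a)))
length-lookup-addAt (suc x) a (y ∷ e) (suc j) = length-lookup-addAt x a e j

length-⁺B : ∀ {m} a → length (_⁺B {m} a) ≡ length a
length-⁺B a = ≡.trans (length-bagPlus (normM a)) (length-normM a)
  where
  length-bagPlus : ∀ {m} b → length (bagPlus {m} b) ≡ length b
  length-bagPlus [] = refl
  length-bagPlus (_ ∷ b) = cong suc (length-bagPlus b)
  length-normM : ∀ b → length (normM b) ≡ length b
  length-normM [] = refl
  length-normM (_ ∷ b) = cong suc (length-normM b)

occL-closed : ∀ {n} j (P : List (Term n)) → All (λ L → occ j L ≡ 0) P → occL j P ≡ 0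
occL-closed j [] [] = refl
occL-closed j (L ∷ P) (o ∷ os) = cong₂ _+_ o (occL-closed j P os)

substFold-occ : ∀ {n} (L : List (Fin n × MF)) (S : Sum (Term n)) {u} → u ∈ substFold L S →
  Σ (Term n) λ s → s ∈ S × (∀ j → occ j u + length (lookup (addAll L emptyE) j) ≡ occ j s)
substFold-occ [] S {u} u∈ = u , u∈ , λ j → ≡.trans (cong (occ j u +_) (length-emptyE j)) (+-identityʳ _)
substFold-occ ((x , a) ∷ L) S {u} u∈ with substFold-occ L (lsubBag S x (a ⁺B)) u∈
... | s₁ , s₁∈ , occ₁ with lsubBag-origin S x (a ⁺B) s₁∈
...   | s , s∈ , _ , occ₂ = s , s∈ , λ j → begin
    occ j u + length (lookup (addAt x a e) j)
      ≡⟨ cong (occ j u +_) (length-lookup-addAt x a e j) ⟩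
    occ j u + (length a Nat.* occVar j x + length (lookup e j))
      ≡⟨ x∙yz≈xz∙y (occ j u) _ _ ⟩
    occ j u + length (lookup e j) + length a Nat.* occVar j x
      ≡⟨ cong (_+ length a Nat.* occVar j x) (occ₁ j) ⟩
    occ j s₁ + length a Nat.* occVar j x
      ≡⟨ cong (λ k → occ j s₁ + k Nat.* occVar j x) (length-⁺B a) ⟨
    occ j s₁ + length (a ⁺B) Nat.* occVar j x
      ≡⟨ occ₂ j ⟩
    occ j s + occL j (a ⁺B)
      ≡⟨ cong (occ j s +_) (occL-closed j (a ⁺B) (occ-bagPlus j (normM a))) ⟩
    occ j s + 0
      ≡⟨ +-identityʳ _ ⟩
    occ j s
      ∎
  where
  open ≡-Reasoning
  e = addAll L emptyE

substAll-closed : ∀ {n} (M : Term n) a α → Sem M a α → ∀ {t} → t ∈ substAll M a → Closed t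
substAll-closed {n} M a α s t∈ j with substFold-occ (toList (zip (allFin n) a)) [ M ] t∈
... | _ , here refl , occ≡ =
  +-cancelʳ-≡ _ _ 0 (≡.trans (occ≡ j) (≡.trans (Sem-linear s j) (≡.sym (length-≈E (addAll-allFin a) j))))

occ-apps : ∀ {m} j (t : Term m) as → occ j (apps t as) ≡ occ j t
occ-apps j t [] = refl
occ-apps j t (a ∷ as) = ≡.trans (occ-apps j (app t (bagPlus a)) as)
  (≡.trans (cong (occ j t +_) (occL-closed j (bagPlus a) (occ-bagPlus j a))) (+-identityʳ _))

occL-⁻[] : ∀ {m} α (t : Term m) j → occL j (α ⁻[ t ]) ≡ occ j t
occL-⁻[] (mk as) t j = ≡.trans (+-identityʳ _) (occ-apps j t (normS as))

tests-closed : ∀ {n} (M : Term n) a α → Sem M a α → All ClosedL (α ⁻[ substAll M a ]Σ)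
tests-closed M a α s = All.tabulate λ V∈ → closedL V∈
  where
  closedL : ∀ {V} → V ∈ α ⁻[ substAll M a ]Σ → ClosedL V
  closedL V∈ j with ∈-map⁻ (α ⁻[_]) V∈
  ... | t , t∈ , refl = ≡.trans (occL-⁻[] α t j) (substAll-closed M a α s t∈ j)

units≈Σε : ∀ {n} {R : Sum (Test n)} {P : Test n → Set} → All (_≡ ε) R → Any P R → R ≈Σ[ _≃L_ ] [ ε ]
units≈Σε units p with find p
... | _ , V∈ , _ =
  All.map (λ { refl → here [] }) units , lose V∈ (subst (_≃L ε) (≡.sym (All.lookup units V∈)) []) ∷ []

proposition5p10 : (n : ℕ) (M : Term n) (a : Env n) (α : D) →
    Sem M a α ⇔ ((α ⁻[ substAll M a ]Σ) ↠T (ε ∷ []))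
proposition5p10 n M a α = mk⇔ reduces expands
  where
  tests = α ⁻[ substAll M a ]Σ
  reduces : Sem M a α → tests ↠T [ ε ]
  reduces s with closed-normalises tests (tests-closed M a α s)
  ... | R , rs , units =
    R , steps , units≈Σε units (Star-reduce steps (Equivalence.from (substAll-Sem M a α) s))
    where steps = Star-map ↦⇒SumStep rs
  expands : tests ↠T [ ε ] → Sem M a α
  expands r = Equivalence.to (substAll-Sem M a α) (↠T-expand r (here (t-nil ≈E-refl)))
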